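{- For every odd $k\ge3$, $\alpha(k\mathrm{AND})=\alpha'_k$, and for every even $k\ge2$, $\alpha(k\mathrm{AND})=2\alpha'_{k+1}$, where $\alpha'_k=\left(\frac{(k-1)(k+1)}{4k^2}\right)^{(k-1)/2}$.
   Context: For $\mathbf a\in\mathbb Z_2^k$, $\|\mathbf a\|_0$ is its Hamming weight. $k\mathrm{AND}:\mathbb Z_2^k\to\{0,1\}$ is $k\mathrm{AND}(\mathbf a)=\prod_{i}a_i$. $\mathcal B_p$ is the distribution on $\{0,1\}$ giving $0$ probability $p$ and $1$ probability $1-p$; $\mathcal B_p^k$ is its $k$-fold product. For a predicate $f:\mathbb Z_2^k\to\{0,1\}$, a distribution $\mathcal D$ on $\mathbb Z_2^k$ and $p\in[0,1]$, define $\lambda_f(\mathcal D,p)=\mathbb E_{\mathbf b\sim\mathcal D,\mathbf a\sim\mathcal B_p^k}[f(\mathbf a+\mathbf b)]$ (addition mod 2), $\gamma_f(\mathcal D)=\lambda_f(\mathcal D,1)=\mathbb E_{\mathbf b\sim\mathcal D}[f(\mathbf b)]$, and $\beta_f(\mathcal D)=\sup_{p\in[0,1]}\lambda_f(\mathcal D,p)$. The marginal vector $\boldsymbol\mu(\mathcal D)\in[-1,1]^k$ has entries $\mu(\mathcal D)_i=-\mathbb E_{\mathbf a\sim\mathcal D}[(-1)^{a_i}]$. Define $\alpha(f)=\inf\{\beta_f(\mathcal D_N)/\gamma_f(\mathcal D_Y)\}$ over all pairs of distributions $\mathcal D_N,\mathcal D_Y$ on $\mathbb Z_2^k$ with $\boldsymbol\mu(\mathcal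 D_N)=\boldsymbol\mu(\mathcal D_Y)$ (ratios with zero denominator read as $+\infty$). (By prior work this is the optimal approximation ratio for $\sqrt n$-space sketching algorithms for the Boolean CSP with predicate $f$ and negations, but the claim concerns only the quantity $\alpha(f)$.)
   Formalization: The distributions $\mathcal D_N,\mathcal D_Y$ take rational weights, and the supremum defining $\beta_f(\mathcal D)$ is taken over rational $p\in[0,1]$ only. -}

module Defs where

open import Data.Bool using (Bool; true; false; _∧_; _xor_)
open import Data.Nat as ℕ using (ℕ; zero; suc)
open import Data.Integer using (+_)
open import Data.Rational using (ℚ; 0ℚ; 1ℚ; _+_; _*_; _-_; -_; _≤_; _<_; _/_)
open import Data.List using (List; []; _∷_; map; _++_; foldr)
open import Data.Vec using (Vec; []; _∷_; lookup; zipWith)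
open import Data.Fin using (Fin)
open import Data.Product using (Σ; _×_; ∃; ∃-syntax)
open import Relation.Binary.PropositionalEquality using (_≡_)

-- Z_2^k is modelled as Vec Bool k (false = 0, true = 1); addition mod 2 is xor.

allVecs : (k : ℕ) → List (Vec Bool k)
allVecs zero    = [] ∷ []
allVecs (suc k) = map (false ∷_) (allVecs k) ++ map (true ∷_) (allVecs k)

sumZ2 : {k : ℕ} → (Vec Bool k → ℚ) → ℚ
sumZ2 {k} g = foldr (λ a s → g a + s) 0ℚ (allVecs k)

_^ℚ_ : ℚ → ℕ → ℚ
q ^ℚ zero  = 1ℚ
q ^ℚ suc n = q * (q ^ℚ n)

bitℚ : Bool → ℚ
bitℚ false = 0ℚ
bitℚ true  = 1ℚ

Pred : ℕ → Set
Pred k = Vec Bool k → Bool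

kAND : (k : ℕ) → Pred k
kAND zero    []      = true
kAND (suc k) (b ∷ a) = b ∧ kAND k a

IsDist : {k : ℕ} → (Vec Bool k → ℚ) → Set
IsDist D = (∀ a → 0ℚ ≤ D a) × sumZ2 D ≡ 1ℚ

-- probability of a ∈ Z_2^k under B_p^k (each coordinate is 0 w.p. p, 1 w.p. 1-p)
bernProb : {k : ℕ} → ℚ → Vec Bool k → ℚ
bernProb p []          = 1ℚ
bernProb p (false ∷ a) = p * bernProb p a
bernProb p (true ∷ a)  = (1ℚ - p) * bernProb p a

lam : {k : ℕ} → Pred k → (Vec Bool k → ℚ) → ℚ → ℚ
lam f D p = sumZ2 (λ b → D b * sumZ2 (λ a → bernProb p a * bitℚ (f (zipWith _xor_ a b))))

gam : {k : ℕ} → Pred k → (Vec Bool k → ℚ) → ℚ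
gam f D = sumZ2 (λ b → D b * bitℚ (f b))

signℚ : Bool → ℚ
signℚ false = 1ℚ
signℚ true  = - 1ℚ

marg : {k : ℕ} → (Vec Bool k → ℚ) → Fin k → ℚ
marg D i = - sumZ2 (λ a → D a * signℚ (lookup a i))

-- Lower-bound half of "α(f) = c":
-- for every pair with equal marginals, β_f(D_N) ≥ c · γ_f(D_Y),
-- where β_f(D_N) = sup_{p ∈ [0,1]} λ_f(D_N,p), expressed as
-- ∀ ε > 0, ∃ p ∈ [0,1] ∩ ℚ with λ_f(D_N,p) > c·γ_f(D_Y) - ε.
AlphaLower : {k : ℕ} → Pred k → ℚ → Set
AlphaLower {k} f c =
  (DN DY : Vec Bool k → ℚ) → IsDist DN → IsDist DY →
  ((i : Fin k) → marg DN i ≡ marg DY i) →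
  (ε : ℚ) → 0ℚ < ε →
  ∃[ p ] (0ℚ ≤ p × p ≤ 1ℚ × (c * gam f DY) - ε < lam f DN p)

-- Upper-bound (tightness) half of "α(f) = c":
-- ∀ ε > 0 there is a pair with equal marginals, γ_f(D_Y) > 0 and
-- β_f(D_N) ≤ (c + ε) · γ_f(D_Y).
AlphaUpper : {k : ℕ} → Pred k → ℚ → Set
AlphaUpper {k} f c =
  (ε : ℚ) → 0ℚ < ε →
  ∃[ DN ] ∃[ DY ] (IsDist DN × IsDist DY ×
    ((i : Fin k) → marg DN i ≡ marg DY i) ×
    0ℚ < gam f DY ×
    ((p : ℚ) → 0ℚ ≤ p → p ≤ 1ℚ → lam f DN p ≤ (c + ε) * gam f DY))

-- α(f) = c  (infimum of β_f(D_N)/γ_f(D_Y) over pairs with equal marginals)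
AlphaIs : {k : ℕ} → Pred k → ℚ → Set
AlphaIs f c = AlphaLower f c × AlphaUpper f c

-- α'_k = ((k-1)(k+1)/(4k²))^((k-1)/2), for odd k (so (k-1)/2 ∈ ℕ), k ≥ 1.
alpha' : (k : ℕ) → ℚ
alpha' zero    = 0ℚ   -- unused junk value
alpha' (suc m) =
  ((+ (m ℕ.* (m ℕ.+ 2))) / (4 ℕ.* (suc m ℕ.* suc m))) ^ℚ (m ℕ./ 2)

{-# OPTIONS --safe #-}
module Submission where

-- Since a + b = 1⋯1 exactly when a is the complement of b, λ(D,p) = E_{b∼D}[p^|b| (1−p)^(k−|b|)] for kAND, where
-- |b| is the Hamming weight. Write k = 2m+1 or k = 2m and let P = (m+1)/(2m+1), so that α'_{2m+1} = (P(1−P))^m.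
--
-- Lower bound: by Bernoulli's inequality, j ↦ (m+1)^j m^(2m+1−j) / j is smallest at j = m and j = m+1, which gives
-- c·|b| ≤ k·P^|b| (1−P)^(k−|b|) for every b, c being the claimed value of α. Averaging over D_N and using that E|b| is
-- the sum of the marginals Pr[b_i = 1], which D_N and D_Y share, λ(D_N,P) ≥ (c/k)·E_{D_Y}|b| ≥ c·γ(D_Y).
--
-- Upper bound: D_N is uniform on the slice |b| = m+1 (k odd), or mixes the slices |b| = m and |b| = m+1 in the
-- ratio (m+1)² : m² (k even); D_Y puts mass t on 1⋯1 and 1−t on 0⋯0, where t is the common marginal of D_N, so
-- γ(D_Y) = t. AM–GM in the form x^n((n+1)y − nx) ≤ y^(n+1), with x = p(1−p) and y = P(1−P), reduces
-- λ(D_N,p) ≤ c·t to a quadratic inequality in p whose slack is a multiple of ((2m+1)p − (m+1))².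

open import Defs

module _ where
  open import Data.Nat
  open import Data.Nat.Properties
  open import Data.Nat.Combinatorics using (_C_; nCk+nC[k+1]≡[n+1]C[k+1])
  open import Data.Nat.Tactic.RingSolver using (solve-∀)
  open import Data.Parity.Base using (0ℙ; 1ℙ)
  open import Data.Sum using (inj₁; inj₂)
  open import Data.Product using (_,_; ∃)
  open import Relation.Binary.PropositionalEquality
  open ≤-Reasoning

  -- Bernoulli-type inequalities and other facts about ℕ

  bernoulli-up : ∀ m u → m ^ u * (suc m + u) ≤ suc m ^ suc u
  bernoulli-up m zero = ≤-reflexive (base m)
    where
    base : ∀ m → 1 * (suc m + 0) ≡ suc m * 1
    base = solve-∀
  bernoulli-up m (suc u) = begin
    m ^ suc u * (suc m + suc u)          ≡⟨ regroup m (m ^ u) u ⟩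
    m ^ u * (m * (m + u + 2))            ≤⟨ *-monoʳ-≤ (m ^ u) (m≤m+n _ (1 + u)) ⟩
    m ^ u * (m * (m + u + 2) + (1 + u))  ≡⟨ expand m (m ^ u) u ⟩
    suc m * (m ^ u * (suc m + u))        ≤⟨ *-monoʳ-≤ (suc m) (bernoulli-up m u) ⟩
    suc m * suc m ^ suc u                ∎
    where
    regroup : ∀ m a u → m * a * (suc m + suc u) ≡ a * (m * (m + u + 2))
    regroup = solve-∀
    expand : ∀ m a u → a * (m * (m + u + 2) + (1 + u)) ≡ suc m * (a * (suc m + u))
    expand = solve-∀

  bernoulli-down : ∀ m s j → j + s ≡ m → suc m ^ s * j ≤ m ^ suc s
  bernoulli-down m zero j j+0≡m = ≤-reflexive (begin-equality
    1 * j  ≡⟨ *-identityˡ j ⟩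
    j      ≡⟨ trans (sym (+-identityʳ j)) j+0≡m ⟩
    m      ≡⟨ sym (*-identityʳ m) ⟩
    m * 1  ∎)
  bernoulli-down m (suc s) j j+s+1≡m = begin
    suc m ^ suc s * j        ≡⟨ regroup (suc m) (suc m ^ s) j ⟩
    suc m ^ s * (suc m * j)  ≤⟨ *-monoʳ-≤ (suc m ^ s) step ⟩
    suc m ^ s * (m * suc j)  ≡⟨ regroup′ m (suc m ^ s) (suc j) ⟩
    m * (suc m ^ s * suc j)  ≤⟨ *-monoʳ-≤ m (bernoulli-down m s (suc j) (trans (sym (+-suc j s)) j+s+1≡m)) ⟩
    m * m ^ suc s            ∎
    where
    regroup : ∀ a b j → a * b * j ≡ b * (a * j)
    regroup = solve-∀
    regroup′ : ∀ a b j → b * (a * j) ≡ a * (b * j)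
    regroup′ = solve-∀
    step : suc m * j ≤ m * suc j
    step = begin
      suc m * j  ≡⟨⟩
      j + m * j  ≤⟨ +-monoˡ-≤ (m * j) (subst (j ≤_) j+s+1≡m (m≤m+n j (suc s))) ⟩
      m + m * j  ≡⟨ sym (*-suc m j) ⟩
      m * suc j  ∎

  m+m≡m*2 : ∀ m → m + m ≡ m * 2
  m+m≡m*2 = solve-∀

  middle-bound-left : ∀ m j l s → j + s ≡ m → j + l ≡ suc (m * 2) → suc m ^ m * m ^ m * j ≤ suc m ^ j * m ^ l
  middle-bound-left m j l s j+s≡m j+l≡2m+1 = begin
    suc m ^ m * m ^ m * j                ≡⟨ cong (λ e → suc m ^ e * m ^ m * j) (sym j+s≡m) ⟩
    suc m ^ (j + s) * m ^ m * j          ≡⟨ cong (λ x → x * m ^ m * j) (^-distribˡ-+-* (suc m) j s) ⟩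
    suc m ^ j * suc m ^ s * m ^ m * j    ≡⟨ regroup (suc m ^ j) (suc m ^ s) (m ^ m) j ⟩
    suc m ^ j * m ^ m * (suc m ^ s * j)  ≤⟨ *-monoʳ-≤ (suc m ^ j * m ^ m) (bernoulli-down m s j j+s≡m) ⟩
    suc m ^ j * m ^ m * m ^ suc s        ≡⟨ *-assoc (suc m ^ j) (m ^ m) (m ^ suc s) ⟩
    suc m ^ j * (m ^ m * m ^ suc s)      ≡⟨ cong (suc m ^ j *_) (sym (^-distribˡ-+-* m m (suc s))) ⟩
    suc m ^ j * m ^ (m + suc s)          ≡⟨ cong (λ e → suc m ^ j * m ^ e) (+-cancelˡ-≡ j _ _ l-eq) ⟩
    suc m ^ j * m ^ l                    ∎
    where
    regroup : ∀ a b c j → a * b * c * j ≡ a * c * (b * j)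
    regroup = solve-∀
    shuffle : ∀ j m s → j + (m + suc s) ≡ suc (m + (j + s))
    shuffle = solve-∀
    l-eq : j + (m + suc s) ≡ j + l
    l-eq = begin-equality
      j + (m + suc s)    ≡⟨ shuffle j m s ⟩
      suc (m + (j + s))  ≡⟨ cong (λ x → suc (m + x)) j+s≡m ⟩
      suc (m + m)        ≡⟨ cong suc (m+m≡m*2 m) ⟩
      suc (m * 2)        ≡⟨ sym j+l≡2m+1 ⟩
      j + l              ∎

  middle-bound-right : ∀ m j l u → suc m + u ≡ j → j + l ≡ suc (m * 2) → suc m ^ m * m ^ m * j ≤ suc m ^ j * m ^ l
  middle-bound-right m j l u m+1+u≡j j+l≡2m+1 = begin
    suc m ^ m * m ^ m * j                      ≡⟨ cong₂ (λ e x → suc m ^ m * m ^ e * x) (sym (+-cancelˡ-≡ (suc m) _ _ l-eq)) (sym m+1+u≡j) ⟩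
    suc m ^ m * m ^ (l + u) * (suc m + u)      ≡⟨ cong (λ x → suc m ^ m * x * (suc m + u)) (^-distribˡ-+-* m l u) ⟩
    suc m ^ m * (m ^ l * m ^ u) * (suc m + u)  ≡⟨ regroup (suc m ^ m) (m ^ l) (m ^ u) (suc m + u) ⟩
    suc m ^ m * m ^ l * (m ^ u * (suc m + u))  ≤⟨ *-monoʳ-≤ (suc m ^ m * m ^ l) (bernoulli-up m u) ⟩
    suc m ^ m * m ^ l * suc m ^ suc u          ≡⟨ swap (suc m ^ m) (m ^ l) (suc m ^ suc u) ⟩
    suc m ^ m * suc m ^ suc u * m ^ l          ≡⟨ cong (_* m ^ l) (sym (^-distribˡ-+-* (suc m) m (suc u))) ⟩
    suc m ^ (m + suc u) * m ^ l                ≡⟨ cong (λ e → suc m ^ e * m ^ l) (trans (+-suc m u) m+1+u≡j) ⟩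
    suc m ^ j * m ^ l                          ∎
    where
    regroup : ∀ a b c d → a * (b * c) * d ≡ a * b * (c * d)
    regroup = solve-∀
    swap : ∀ a b c → a * b * c ≡ a * c * b
    swap = solve-∀
    shuffle : ∀ m l u → suc m + (l + u) ≡ suc m + u + l
    shuffle = solve-∀
    l-eq : suc m + (l + u) ≡ suc m + m
    l-eq = begin-equality
      suc m + (l + u)  ≡⟨ shuffle m l u ⟩
      suc m + u + l    ≡⟨ cong (_+ l) m+1+u≡j ⟩
      j + l            ≡⟨ j+l≡2m+1 ⟩
      suc (m * 2)      ≡⟨ cong suc (sym (m+m≡m*2 m)) ⟩
      suc m + m        ∎

  middle-bound : ∀ m j l → j + l ≡ suc (m * 2) → suc m ^ m * m ^ m * j ≤ suc m ^ j * m ^ l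
  middle-bound m j l j+l≡2m+1 with ≤-<-connex j m
  ... | inj₁ j≤m = let s , j+s≡m = m≤n⇒∃[o]m+o≡n j≤m in middle-bound-left m j l s j+s≡m j+l≡2m+1
  ... | inj₂ m<j = let u , m+1+u≡j = m≤n⇒∃[o]m+o≡n m<j in middle-bound-right m j l u m+1+u≡j j+l≡2m+1

  0<C : ∀ {k j} → j ≤ k → 0 < k C j
  0<C {k} {zero} _ = s≤s z≤n
  0<C {suc k} {suc j} (s≤s j≤k) = <-≤-trans (0<C j≤k)
    (subst (k C j ≤_) (nCk+nC[k+1]≡[n+1]C[k+1] k j) (m≤m+n (k C j) (k C suc j)))

  odd-form : ∀ k → parity k ≡ 1ℙ → ∃ λ m → k ≡ suc (m * 2)
  odd-form (suc zero) _ = 0 , refl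
  odd-form (suc (suc k)) odd with odd-form k odd
  ... | m , refl = suc m , refl

  even-form : ∀ k → parity k ≡ 0ℙ → ∃ λ m → k ≡ m * 2
  even-form zero _ = 0 , refl
  even-form (suc (suc k)) even with even-form k even
  ... | m , refl = suc m , refl


module _ where
  open import Algebra.Bundles using (CommutativeRing; CommutativeMonoid)
  open import Data.Bool using (Bool; true; false; _xor_; T)
  open import Data.Fin using (Fin)
  import Data.Integer as ℤ
  import Data.Integer.Properties as ℤₚ
  import Data.Fin as Fin
  open import Data.List using (List; []; _∷_; map; _++_; foldr)
  open import Data.Nat.Base as ℕ using (ℕ; zero; suc)
  import Data.Nat.Properties as ℕₚ
  open import Data.Nat.DivMod using (m*n/n≡m)
  open import Data.Nat.Combinatorics using (_C_; nCk+nC[k+1]≡[n+1]C[k+1])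
  open import Data.Product using (_,_; proj₂)
  open import Data.Rational
  open import Data.Rational.Properties
  import Data.Rational.Unnormalised as ℚᵘ
  import Data.Rational.Unnormalised.Properties as ℚᵘ
  open import Data.Sum using (inj₁; inj₂)
  open import Data.Vec using (Vec; []; _∷_; lookup; zipWith)
  open import Function using (_∘_)
  open import Level using (0ℓ)
  open import Relation.Binary.PropositionalEquality
  open import Relation.Nullary using (yes; no; contradiction)
  open import Relation.Nullary.Decidable.Core using (dec⇒maybe)
  open import Tactic.RingSolver using (solve-∀)
  open import Tactic.RingSolver.Core.AlmostCommutativeRing using (AlmostCommutativeRing; fromCommutativeRing)
  open import Algebra.Definitions.RawMonoid +-0-rawMonoid using (_×_; sum)
  open import Algebra.Properties.Monoid.Mult +-0-monoid using (×-homo-+)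
  open import Algebra.Properties.Monoid.Sum +-0-monoid using (sum-replicate; sum-cong-≗)
  open import Algebra.Properties.Semiring.Sum (CommutativeRing.semiring +-*-commutativeRing) using (*-distribˡ-sum)
  open import Algebra.Properties.Semiring.Mult (CommutativeRing.semiring +-*-commutativeRing) using (×1-homo-*; ×-assoc-*)
  open import Algebra.Properties.Semiring.Exp (CommutativeRing.semiring +-*-commutativeRing) using (^-homo-*)
  open import Algebra.Properties.CommutativeSemiring.Exp (CommutativeRing.commutativeSemiring +-*-commutativeRing) using (^-distrib-*)
  open import Algebra.Definitions.RawSemiring +-*-rawSemiring using (_^_)
  open import Algebra.Properties.CommutativeSemigroup (CommutativeMonoid.commutativeSemigroup *-1-commutativeMonoid) using (x∙yz≈y∙xz)

  -- Rational arithmetic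

  ℚ-ring : AlmostCommutativeRing 0ℓ 0ℓ
  ℚ-ring = fromCommutativeRing +-*-commutativeRing (dec⇒maybe ∘ (0ℚ ≟_))

  -- n × 1ℚ rather than + n / 1, so that the library's lemmas on _×_ apply; on numerals the two agree by computation.
  fromℕ : ℕ → ℚ
  fromℕ n = n × 1ℚ

  fromℕ-+ : ∀ m n → fromℕ (m ℕ.+ n) ≡ fromℕ m + fromℕ n
  fromℕ-+ = ×-homo-+ 1ℚ

  fromℕ-* : ∀ m n → fromℕ (m ℕ.* n) ≡ fromℕ m * fromℕ n
  fromℕ-* = ×1-homo-*

  ^ℚ≗^ : ∀ p n → p ^ℚ n ≡ p ^ n
  ^ℚ≗^ p zero = refl
  ^ℚ≗^ p (suc n) = cong (p *_) (^ℚ≗^ p n)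

  ^ℚ-+ : ∀ p m n → p ^ℚ (m ℕ.+ n) ≡ p ^ℚ m * p ^ℚ n
  ^ℚ-+ p m n = trans (^ℚ≗^ p (m ℕ.+ n)) (trans (^-homo-* p m n) (sym (cong₂ _*_ (^ℚ≗^ p m) (^ℚ≗^ p n))))

  ^ℚ-* : ∀ p q n → (p * q) ^ℚ n ≡ p ^ℚ n * q ^ℚ n
  ^ℚ-* p q n = trans (^ℚ≗^ (p * q) n) (trans (^-distrib-* p q n) (sym (cong₂ _*_ (^ℚ≗^ p n) (^ℚ≗^ q n))))

  fromℕ-^ : ∀ m n → fromℕ (m ℕ.^ n) ≡ fromℕ m ^ℚ n
  fromℕ-^ m zero = refl
  fromℕ-^ m (suc n) = trans (fromℕ-* m (m ℕ.^ n)) (cong (fromℕ m *_) (fromℕ-^ m n))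

  0<1 : 0ℚ < 1ℚ
  0<1 = *<* (ℤ.+<+ (ℕ.s≤s ℕ.z≤n))

  0≤1 : 0ℚ ≤ 1ℚ
  0≤1 = <⇒≤ 0<1

  drop-zero-term : ∀ {x y e} → e ≡ 0ℚ → x + y * e ≡ x
  drop-zero-term {x} {y} refl = trans (cong (x +_) (*-zeroʳ y)) (+-identityʳ x)

  p≡q⇒p-q≡0 : ∀ {p q} → p ≡ q → p - q ≡ 0ℚ
  p≡q⇒p-q≡0 {p} refl = +-inverseʳ p

  p≤p+q : ∀ p {q} → 0ℚ ≤ q → p ≤ p + q
  p≤p+q p {q} 0≤q = begin
    p       ≡⟨ sym (+-identityʳ p) ⟩
    p + 0ℚ  ≤⟨ +-monoʳ-≤ p 0≤q ⟩
    p + q   ∎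
    where open ≤-Reasoning

  0≤q-p : ∀ {p q} → p ≤ q → 0ℚ ≤ q - p
  0≤q-p {p} {q} p≤q = begin
    0ℚ     ≡⟨ sym (+-inverseʳ p) ⟩
    p - p  ≤⟨ +-monoˡ-≤ (- p) p≤q ⟩
    q - p  ∎
    where open ≤-Reasoning

  +-nonNeg : ∀ {p q} → 0ℚ ≤ p → 0ℚ ≤ q → 0ℚ ≤ p + q
  +-nonNeg = +-mono-≤

  *-nonNeg : ∀ {p q} → 0ℚ ≤ p → 0ℚ ≤ q → 0ℚ ≤ p * q
  *-nonNeg {p} {q} 0≤p 0≤q =
    nonNegative⁻¹ (p * q) {{nonNeg*nonNeg⇒nonNeg p {{nonNegative 0≤p}} q {{nonNegative 0≤q}}}}

  *-pos : ∀ {p q} → 0ℚ < p → 0ℚ < q → 0ℚ < p * q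
  *-pos {p} {q} 0<p 0<q = positive⁻¹ (p * q) {{pos*pos⇒pos p {{positive 0<p}} q {{positive 0<q}}}}

  sq-nonNeg : ∀ p → 0ℚ ≤ p * p
  sq-nonNeg p with ≤-total 0ℚ p
  ... | inj₁ 0≤p = *-nonNeg 0≤p 0≤p
  ... | inj₂ p≤0 = subst (0ℚ ≤_) (neg-sq p) (*-nonNeg 0≤-p 0≤-p)
    where
    0≤-p : 0ℚ ≤ - p
    0≤-p = neg-antimono-≤ p≤0
    neg-sq : ∀ p → (- p) * (- p) ≡ p * p
    neg-sq = solve-∀ ℚ-ring

  ^ℚ-nonNeg : ∀ {p} n → 0ℚ ≤ p → 0ℚ ≤ p ^ℚ n
  ^ℚ-nonNeg zero _ = 0≤1
  ^ℚ-nonNeg (suc n) 0≤p = *-nonNeg 0≤p (^ℚ-nonNeg n 0≤p)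

  *-monoˡ-≤ : ∀ {r p q} → 0ℚ ≤ r → p ≤ q → r * p ≤ r * q
  *-monoˡ-≤ {r} 0≤r = *-monoˡ-≤-nonNeg r {{nonNegative 0≤r}}

  *-cancelˡ-≤ : ∀ {r p q} → 0ℚ < r → r * p ≤ r * q → p ≤ q
  *-cancelˡ-≤ {r} 0<r = *-cancelˡ-≤-pos r {{positive 0<r}}

  *-cancelˡ-≡ : ∀ {r p q} → 0ℚ < r → r * p ≡ r * q → p ≡ q
  *-cancelˡ-≡ 0<r rp≡rq = ≤-antisym (*-cancelˡ-≤ 0<r (≤-reflexive rp≡rq)) (*-cancelˡ-≤ 0<r (≤-reflexive (sym rp≡rq)))

  inv : (q : ℚ) → 0ℚ < q → ℚ
  inv q 0<q = (1/ q) {{>-nonZero 0<q}}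

  *-inv : ∀ q (0<q : 0ℚ < q) → q * inv q 0<q ≡ 1ℚ
  *-inv q 0<q = *-inverseʳ q {{>-nonZero 0<q}}

  inv-pos : ∀ q (0<q : 0ℚ < q) → 0ℚ < inv q 0<q
  inv-pos q 0<q = positive⁻¹ _ {{1/pos⇒pos q {{positive 0<q}}}}

  0≤fromℕ : ∀ n → 0ℚ ≤ fromℕ n
  0≤fromℕ zero = ≤-refl
  0≤fromℕ (suc n) = +-nonNeg {1ℚ} 0≤1 (0≤fromℕ n)

  0<fromℕ : ∀ n → 0ℚ < fromℕ (suc n)
  0<fromℕ n = +-mono-<-≤ {0ℚ} {1ℚ} {0ℚ} {fromℕ n} 0<1 (0≤fromℕ n)

  fromℕ-mono-≤ : ∀ {m n} → m ℕ.≤ n → fromℕ m ≤ fromℕ n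
  fromℕ-mono-≤ {m} m≤n with ℕₚ.m≤n⇒∃[o]m+o≡n m≤n
  ... | o , refl = subst (fromℕ m ≤_) (sym (fromℕ-+ m o)) (p≤p+q (fromℕ m) (0≤fromℕ o))

  module _ where
    open ℤ using (+_)

    toℚᵘ-fromℕ : ∀ n → toℚᵘ (fromℕ n) ℚᵘ.≃ ℚᵘ.mkℚᵘ (+ n) 0
    toℚᵘ-fromℕ zero = ℚᵘ.*≡* refl
    toℚᵘ-fromℕ (suc n) = ℚᵘ.≃-trans (toℚᵘ-homo-+ 1ℚ (fromℕ n))
      (ℚᵘ.≃-trans (ℚᵘ.+-congʳ (toℚᵘ 1ℚ) (toℚᵘ-fromℕ n)) (ℚᵘ.*≡* (eq n)))
      where
      eq : ∀ n → (+ 1 ℤ.* + 1 ℤ.+ + n ℤ.* + 1) ℤ.* + 1 ≡ + suc n ℤ.* + (1 ℕ.* 1)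
      eq n = trans (ℤₚ.*-identityʳ _) (trans (cong (λ x → + 1 ℤ.+ x) (ℤₚ.*-identityʳ (+ n)))
               (trans (sym (ℤₚ.pos-+ 1 n)) (sym (ℤₚ.*-identityʳ (+ suc n)))))

    /-*-cancel : ∀ a b → (+ a / suc b) * fromℕ (suc b) ≡ fromℕ a
    /-*-cancel a b = toℚᵘ-injective (ℚᵘ.≃-trans (toℚᵘ-homo-* (+ a / suc b) (fromℕ (suc b)))
      (ℚᵘ.≃-trans (ℚᵘ.*-cong (toℚᵘ-fromℚᵘ (ℚᵘ.mkℚᵘ (+ a) b)) (toℚᵘ-fromℕ (suc b)))
      (ℚᵘ.≃-trans (ℚᵘ.*≡* (eq a b)) (ℚᵘ.≃-sym (toℚᵘ-fromℕ a)))))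
      where
      eq : ∀ a b → (+ a ℤ.* + suc b) ℤ.* + 1 ≡ + a ℤ.* + (suc b ℕ.* 1)
      eq a b = trans (ℤₚ.*-identityʳ _) (cong (λ d → + a ℤ.* + d) (sym (ℕₚ.*-identityʳ (suc b))))

  -- Sums, expectations and marginals over Z₂ᵏ

  ∑ : {A : Set} → List A → (A → ℚ) → ℚ
  ∑ xs g = foldr (λ a s → g a + s) 0ℚ xs

  module _ {A : Set} where

    ∑-++ : ∀ xs ys (g : A → ℚ) → ∑ (xs ++ ys) g ≡ ∑ xs g + ∑ ys g
    ∑-++ [] ys g = sym (+-identityˡ (∑ ys g))
    ∑-++ (x ∷ xs) ys g = trans (cong (g x +_) (∑-++ xs ys g)) (sym (+-assoc (g x) (∑ xs g) (∑ ys g)))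

    ∑-cong : ∀ xs {f g : A → ℚ} → (∀ a → f a ≡ g a) → ∑ xs f ≡ ∑ xs g
    ∑-cong [] f≗g = refl
    ∑-cong (x ∷ xs) f≗g = cong₂ _+_ (f≗g x) (∑-cong xs f≗g)

    ∑-+ : ∀ xs (f g : A → ℚ) → ∑ xs (λ a → f a + g a) ≡ ∑ xs f + ∑ xs g
    ∑-+ [] f g = refl
    ∑-+ (x ∷ xs) f g = trans (cong (f x + g x +_) (∑-+ xs f g)) (interchange (f x) (g x) (∑ xs f) (∑ xs g))
      where
      interchange : ∀ a b c d → a + b + (c + d) ≡ a + c + (b + d)
      interchange = solve-∀ ℚ-ring

    ∑-*ˡ : ∀ xs c (f : A → ℚ) → ∑ xs (λ a → c * f a) ≡ c * ∑ xs f
    ∑-*ˡ [] c f = sym (*-zeroʳ c)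
    ∑-*ˡ (x ∷ xs) c f = trans (cong (c * f x +_) (∑-*ˡ xs c f)) (sym (*-distribˡ-+ c (f x) (∑ xs f)))

    ∑-mono : ∀ xs {f g : A → ℚ} → (∀ a → f a ≤ g a) → ∑ xs f ≤ ∑ xs g
    ∑-mono [] f≤g = ≤-refl
    ∑-mono (x ∷ xs) f≤g = +-mono-≤ (f≤g x) (∑-mono xs f≤g)

    ∑-0 : ∀ (xs : List A) → ∑ xs (λ _ → 0ℚ) ≡ 0ℚ
    ∑-0 [] = refl
    ∑-0 (x ∷ xs) = trans (+-identityˡ _) (∑-0 xs)

    ∑-sum-comm : ∀ xs {n} (f : Fin n → A → ℚ) → ∑ xs (λ a → sum (λ i → f i a)) ≡ sum (λ i → ∑ xs (f i))
    ∑-sum-comm xs {zero} f = ∑-0 xs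
    ∑-sum-comm xs {suc n} f = trans (∑-+ xs (f Fin.zero) (λ a → sum (λ i → f (Fin.suc i) a)))
      (cong (∑ xs (f Fin.zero) +_) (∑-sum-comm xs (f ∘ Fin.suc)))

  ∑-map : ∀ {A B : Set} xs (h : A → B) (g : B → ℚ) → ∑ (map h xs) g ≡ ∑ xs (g ∘ h)
  ∑-map [] h g = refl
  ∑-map (x ∷ xs) h g = cong (g (h x) +_) (∑-map xs h g)

  sumZ2-split : ∀ {k} (g : Vec Bool (suc k) → ℚ) → sumZ2 g ≡ sumZ2 (g ∘ (false ∷_)) + sumZ2 (g ∘ (true ∷_))
  sumZ2-split {k} g = trans (∑-++ (map (false ∷_) (allVecs k)) (map (true ∷_) (allVecs k)) g)
    (cong₂ _+_ (∑-map (allVecs k) (false ∷_) g) (∑-map (allVecs k) (true ∷_) g))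

  sum-const : ∀ n c → sum {n} (λ _ → c) ≡ fromℕ n * c
  sum-const n c = trans (sum-replicate n) (sym (trans (×-assoc-* n 1ℚ c) (cong (n ×_) (*-identityˡ c))))

  𝔼 : ∀ {k} → (Vec Bool k → ℚ) → (Vec Bool k → ℚ) → ℚ
  𝔼 D g = sumZ2 (λ b → D b * g b)

  onesProb : ∀ {k} → (Vec Bool k → ℚ) → Fin k → ℚ
  onesProb D i = 𝔼 D (λ b → bitℚ (lookup b i))

  mix : ∀ {k} → ℚ → (Vec Bool k → ℚ) → (Vec Bool k → ℚ) → Vec Bool k → ℚ
  mix t D D′ b = t * D b + (1ℚ - t) * D′ b

  module _ {k : ℕ} where

    𝔼-cong : ∀ (D : Vec Bool k → ℚ) {g h} → (∀ b → g b ≡ h b) → 𝔼 D g ≡ 𝔼 D h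
    𝔼-cong D g≗h = ∑-cong (allVecs k) (λ b → cong (D b *_) (g≗h b))

    𝔼-0 : ∀ (D : Vec Bool k → ℚ) → 𝔼 D (λ _ → 0ℚ) ≡ 0ℚ
    𝔼-0 D = trans (∑-cong (allVecs k) (λ b → *-zeroʳ (D b))) (∑-0 (allVecs k))

    𝔼-mono : ∀ {D : Vec Bool k → ℚ} {g h} → (∀ b → 0ℚ ≤ D b) → (∀ b → g b ≤ h b) → 𝔼 D g ≤ 𝔼 D h
    𝔼-mono 0≤D g≤h = ∑-mono (allVecs k) (λ b → *-monoˡ-≤ (0≤D b) (g≤h b))

    𝔼-*ʳ : ∀ (D : Vec Bool k → ℚ) c g → 𝔼 D (λ b → c * g b) ≡ c * 𝔼 D g
    𝔼-*ʳ D c g = trans (∑-cong (allVecs k) (λ b → x∙yz≈y∙xz (D b) c (g b))) (∑-*ˡ (allVecs k) c (λ b → D b * g b))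

    𝔼-*ˡ : ∀ c (D : Vec Bool k → ℚ) g → 𝔼 (λ b → c * D b) g ≡ c * 𝔼 D g
    𝔼-*ˡ c D g = trans (∑-cong (allVecs k) (λ b → *-assoc c (D b) (g b))) (∑-*ˡ (allVecs k) c (λ b → D b * g b))

    𝔼-mix : ∀ t (D D′ : Vec Bool k → ℚ) g → 𝔼 (mix t D D′) g ≡ t * 𝔼 D g + (1ℚ - t) * 𝔼 D′ g
    𝔼-mix t D D′ g = begin
      𝔼 (mix t D D′) g                                         ≡⟨ ∑-cong (allVecs k) (λ b → distrib t (D b) (D′ b) (g b)) ⟩
      sumZ2 (λ b → t * (D b * g b) + (1ℚ - t) * (D′ b * g b))  ≡⟨ ∑-+ (allVecs k) (λ b → t * (D b * g b)) (λ b → (1ℚ - t) * (D′ b * g b)) ⟩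
      sumZ2 (λ b → t * (D b * g b)) + sumZ2 (λ b → (1ℚ - t) * (D′ b * g b))
        ≡⟨ cong₂ _+_ (∑-*ˡ (allVecs k) t _) (∑-*ˡ (allVecs k) (1ℚ - t) _) ⟩
      t * 𝔼 D g + (1ℚ - t) * 𝔼 D′ g                            ∎
      where
      open ≡-Reasoning
      distrib : ∀ t d d′ x → (t * d + (1ℚ - t) * d′) * x ≡ t * (d * x) + (1ℚ - t) * (d′ * x)
      distrib = solve-∀ ℚ-ring

    sumZ2-*ˡ : ∀ c (D : Vec Bool k → ℚ) → sumZ2 (λ b → c * D b) ≡ c * sumZ2 D
    sumZ2-*ˡ = ∑-*ˡ (allVecs k)

    mix-isDist : ∀ {t} {D D′ : Vec Bool k → ℚ} → 0ℚ ≤ t → t ≤ 1ℚ → IsDist D → IsDist D′ → IsDist (mix t D D′)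
    mix-isDist {t} {D} {D′} 0≤t t≤1 (0≤D , ∑D≡1) (0≤D′ , ∑D′≡1) =
      (λ b → +-nonNeg (*-nonNeg 0≤t (0≤D b)) (*-nonNeg (0≤q-p t≤1) (0≤D′ b))) ,
      (begin
        sumZ2 (mix t D D′)                 ≡⟨ ∑-+ (allVecs k) (λ b → t * D b) (λ b → (1ℚ - t) * D′ b) ⟩
        sumZ2 (λ b → t * D b) + sumZ2 (λ b → (1ℚ - t) * D′ b)
          ≡⟨ cong₂ _+_ (sumZ2-*ˡ t D) (sumZ2-*ˡ (1ℚ - t) D′) ⟩
        t * sumZ2 D + (1ℚ - t) * sumZ2 D′  ≡⟨ cong₂ (λ u v → t * u + (1ℚ - t) * v) ∑D≡1 ∑D′≡1 ⟩
        t * 1ℚ + (1ℚ - t) * 1ℚ             ≡⟨ convex t ⟩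
        1ℚ                                 ∎)
      where
      open ≡-Reasoning
      convex : ∀ t → t * 1ℚ + (1ℚ - t) * 1ℚ ≡ 1ℚ
      convex = solve-∀ ℚ-ring

  marg≡onesProb : ∀ {k} (D : Vec Bool k → ℚ) i → marg D i ≡ onesProb D i + onesProb D i - sumZ2 D
  marg≡onesProb {k} D i = begin
    - sumZ2 (λ b → D b * signℚ (lookup b i))  ≡⟨ cong -_ (∑-cong (allVecs k) (λ b → signed (D b) (lookup b i))) ⟩
    - sumZ2 (λ b → D b + (- 1ℚ - 1ℚ) * (D b * bitℚ (lookup b i)))
      ≡⟨ cong -_ (trans (∑-+ (allVecs k) D (λ b → (- 1ℚ - 1ℚ) * (D b * bitℚ (lookup b i))))
                        (cong (sumZ2 D +_) (∑-*ˡ (allVecs k) (- 1ℚ - 1ℚ) (λ b → D b * bitℚ (lookup b i))))) ⟩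
    - (sumZ2 D + (- 1ℚ - 1ℚ) * onesProb D i)  ≡⟨ rearrange (sumZ2 D) (onesProb D i) ⟩
    onesProb D i + onesProb D i - sumZ2 D     ∎
    where
    open ≡-Reasoning
    signed : ∀ d x → d * signℚ x ≡ d + (- 1ℚ - 1ℚ) * (d * bitℚ x)
    signed d false = signed-false d
      where
      signed-false : ∀ d → d * 1ℚ ≡ d + (- 1ℚ - 1ℚ) * (d * 0ℚ)
      signed-false = solve-∀ ℚ-ring
    signed d true = signed-true d
      where
      signed-true : ∀ d → d * - 1ℚ ≡ d + (- 1ℚ - 1ℚ) * (d * 1ℚ)
      signed-true = solve-∀ ℚ-ring
    rearrange : ∀ s a → - (s + (- 1ℚ - 1ℚ) * a) ≡ a + a - s
    rearrange = solve-∀ ℚ-ring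

  module _ {k} (D D′ : Vec Bool k → ℚ) (i : Fin k) (∑D≡∑D′ : sumZ2 D ≡ sumZ2 D′) where

    same-onesProb⇒same-marg : onesProb D i ≡ onesProb D′ i → marg D i ≡ marg D′ i
    same-onesProb⇒same-marg ones≡ = begin
      marg D i                                  ≡⟨ marg≡onesProb D i ⟩
      onesProb D i + onesProb D i - sumZ2 D     ≡⟨ cong₂ (λ a s → a + a - s) ones≡ ∑D≡∑D′ ⟩
      onesProb D′ i + onesProb D′ i - sumZ2 D′  ≡⟨ sym (marg≡onesProb D′ i) ⟩
      marg D′ i                                 ∎
      where open ≡-Reasoning

    same-marg⇒same-onesProb : marg D i ≡ marg D′ i → onesProb D i ≡ onesProb D′ i
    same-marg⇒same-onesProb marg≡ = begin
      onesProb D i                                               ≡⟨ halve (onesProb D i) (sumZ2 D) ⟩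
      ½ * (onesProb D i + onesProb D i - sumZ2 D + sumZ2 D)      ≡⟨ cong₂ (λ m s → ½ * (m + s)) (trans (sym (marg≡onesProb D i)) marg≡) ∑D≡∑D′ ⟩
      ½ * (marg D′ i + sumZ2 D′)                                 ≡⟨ cong (λ m → ½ * (m + sumZ2 D′)) (marg≡onesProb D′ i) ⟩
      ½ * (onesProb D′ i + onesProb D′ i - sumZ2 D′ + sumZ2 D′)  ≡⟨ sym (halve (onesProb D′ i) (sumZ2 D′)) ⟩
      onesProb D′ i                                              ∎
      where
      open ≡-Reasoning
      halve : ∀ a s → a ≡ ½ * (a + a - s + s)
      halve = solve-∀ ℚ-ring

  -- Hamming weight and uniform slices

  weight : ∀ {k} → Vec Bool k → ℕ
  weight [] = 0
  weight (true ∷ b) = suc (weight b)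
  weight (false ∷ b) = weight b

  zeros : ∀ {k} → Vec Bool k → ℕ
  zeros [] = 0
  zeros (true ∷ b) = zeros b
  zeros (false ∷ b) = suc (zeros b)

  weight+zeros : ∀ {k} (b : Vec Bool k) → weight b ℕ.+ zeros b ≡ k
  weight+zeros [] = refl
  weight+zeros (true ∷ b) = cong suc (weight+zeros b)
  weight+zeros (false ∷ b) = trans (ℕₚ.+-suc (weight b) (zeros b)) (cong suc (weight+zeros b))

  weight≡⇒zeros≡ : ∀ {k j l} (b : Vec Bool k) → weight b ≡ j → j ℕ.+ l ≡ k → zeros b ≡ l
  weight≡⇒zeros≡ b refl w+l≡k = ℕₚ.+-cancelˡ-≡ (weight b) _ _ (trans (weight+zeros b) (sym w+l≡k))

  sum-bits≡weight : ∀ {k} (b : Vec Bool k) → sum (λ i → bitℚ (lookup b i)) ≡ fromℕ (weight b)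
  sum-bits≡weight [] = refl
  sum-bits≡weight (true ∷ b) = cong (1ℚ +_) (sum-bits≡weight b)
  sum-bits≡weight (false ∷ b) = trans (+-identityˡ _) (sum-bits≡weight b)

  𝔼-weight≡sum-onesProb : ∀ {k} (D : Vec Bool k → ℚ) → 𝔼 D (fromℕ ∘ weight) ≡ sum (onesProb D)
  𝔼-weight≡sum-onesProb {k} D = begin
    𝔼 D (fromℕ ∘ weight)                               ≡⟨ 𝔼-cong D (λ b → sym (sum-bits≡weight b)) ⟩
    sumZ2 (λ b → D b * sum (λ i → bitℚ (lookup b i)))  ≡⟨ ∑-cong (allVecs k) (λ b → *-distribˡ-sum (D b) (λ i → bitℚ (lookup b i))) ⟩
    sumZ2 (λ b → sum (λ i → D b * bitℚ (lookup b i)))  ≡⟨ ∑-sum-comm (allVecs k) (λ i b → D b * bitℚ (lookup b i)) ⟩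
    sum (onesProb D)                                   ∎
    where open ≡-Reasoning

  slice : ∀ {k} → ℕ → Vec Bool k → ℚ
  slice j b = bitℚ (weight b ℕ.≡ᵇ j)

  module _ {k j : ℕ} (b : Vec Bool k) where

    slice-≢ : weight b ≢ j → slice j b ≡ 0ℚ
    slice-≢ w≢j with weight b ℕ.≡ᵇ j in eq
    ... | false = refl
    ... | true = contradiction (ℕₚ.≡ᵇ⇒≡ (weight b) j (subst T (sym eq) _)) w≢j

    slice-nonNeg : 0ℚ ≤ slice j b
    slice-nonNeg with weight b ℕ.≡ᵇ j
    ... | false = ≤-refl
    ... | true = 0≤1

    slice-*-cong : ∀ {x y} → (weight b ≡ j → x ≡ y) → slice j b * x ≡ slice j b * y
    slice-*-cong {x} {y} w≡j⇒x≡y with weight b ℕₚ.≟ j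
    ... | yes w≡j = cong (slice j b *_) (w≡j⇒x≡y w≡j)
    ... | no w≢j = trans (cong (_* x) (slice-≢ w≢j)) (trans (*-zeroˡ x) (sym (trans (cong (_* y) (slice-≢ w≢j)) (*-zeroˡ y))))

  weight≡0⇒lookup≡false : ∀ {k} (b : Vec Bool k) i → weight b ≡ 0 → lookup b i ≡ false
  weight≡0⇒lookup≡false (false ∷ b) Fin.zero _ = refl
  weight≡0⇒lookup≡false (false ∷ b) (Fin.suc i) w≡0 = weight≡0⇒lookup≡false b i w≡0

  𝔼-slice : ∀ {k j} {g : Vec Bool k → ℚ} {c} → (∀ b → weight b ≡ j → g b ≡ c) → 𝔼 (slice j) g ≡ sumZ2 {k} (slice j) * c
  𝔼-slice {k} {j} {g} {c} g≡c = begin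
    𝔼 (slice j) g                    ≡⟨ ∑-cong (allVecs k) (λ b → trans (slice-*-cong b (g≡c b)) (*-comm (slice j b) c)) ⟩
    sumZ2 {k} (λ b → c * slice j b)  ≡⟨ sumZ2-*ˡ {k} c (slice j) ⟩
    c * sumZ2 {k} (slice j)          ≡⟨ *-comm c _ ⟩
    sumZ2 {k} (slice j) * c          ∎
    where open ≡-Reasoning

  ∑-slice : ∀ k j → sumZ2 {k} (slice j) ≡ fromℕ (k C j)
  ∑-slice zero zero = refl
  ∑-slice zero (suc j) = refl
  ∑-slice (suc k) zero = begin
    sumZ2 {suc k} (slice 0)                     ≡⟨ sumZ2-split {k} (slice 0) ⟩
    sumZ2 {k} (slice 0) + sumZ2 {k} (λ _ → 0ℚ)  ≡⟨ cong₂ _+_ (∑-slice k 0) (∑-0 (allVecs k)) ⟩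
    fromℕ 1 + 0ℚ                                ≡⟨ +-identityʳ (fromℕ 1) ⟩
    fromℕ 1                                     ∎
    where open ≡-Reasoning
  ∑-slice (suc k) (suc j) = begin
    sumZ2 {suc k} (slice (suc j))                    ≡⟨ sumZ2-split {k} (slice (suc j)) ⟩
    sumZ2 {k} (slice (suc j)) + sumZ2 {k} (slice j)  ≡⟨ cong₂ _+_ (∑-slice k (suc j)) (∑-slice k j) ⟩
    fromℕ (k C suc j) + fromℕ (k C j)                ≡⟨ +-comm (fromℕ (k C suc j)) (fromℕ (k C j)) ⟩
    fromℕ (k C j) + fromℕ (k C suc j)                ≡⟨ sym (fromℕ-+ (k C j) (k C suc j)) ⟩
    fromℕ (k C j ℕ.+ k C suc j)                      ≡⟨ cong fromℕ (nCk+nC[k+1]≡[n+1]C[k+1] k j) ⟩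
    fromℕ (suc k C suc j)                            ∎
    where open ≡-Reasoning

  onesProb-slice₀ : ∀ {k} (i : Fin k) → onesProb (slice 0) i ≡ 0ℚ
  onesProb-slice₀ {k} i = begin
    𝔼 {k} (slice 0) (λ b → bitℚ (lookup b i))  ≡⟨ 𝔼-slice (λ b w≡0 → cong bitℚ (weight≡0⇒lookup≡false b i w≡0)) ⟩
    sumZ2 {k} (slice 0) * 0ℚ                   ≡⟨ *-zeroʳ (sumZ2 {k} (slice 0)) ⟩
    0ℚ                                         ∎
    where open ≡-Reasoning

  onesProb-slice : ∀ k j (i : Fin (suc k)) → onesProb (slice (suc j)) i ≡ fromℕ (k C j)
  onesProb-slice k j Fin.zero = begin
    onesProb {suc k} (slice (suc j)) Fin.zero
      ≡⟨ sumZ2-split {k} (λ b → slice (suc j) b * bitℚ (lookup b Fin.zero)) ⟩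
    sumZ2 {k} (λ b → slice (suc j) b * 0ℚ) + sumZ2 {k} (λ b → slice j b * 1ℚ)
      ≡⟨ cong₂ _+_ (trans (∑-cong (allVecs k) (λ b → *-zeroʳ (slice (suc j) b))) (∑-0 (allVecs k)))
                   (∑-cong (allVecs k) (λ b → *-identityʳ (slice j b))) ⟩
    0ℚ + sumZ2 {k} (slice j)  ≡⟨ +-identityˡ _ ⟩
    sumZ2 {k} (slice j)       ≡⟨ ∑-slice k j ⟩
    fromℕ (k C j)             ∎
    where open ≡-Reasoning
  onesProb-slice (suc k) zero (Fin.suc i) = begin
    onesProb {suc (suc k)} (slice 1) (Fin.suc i)         ≡⟨ sumZ2-split {suc k} (λ b → slice 1 b * bitℚ (lookup b (Fin.suc i))) ⟩
    onesProb {suc k} (slice 1) i + onesProb (slice 0) i  ≡⟨ cong₂ _+_ (onesProb-slice k 0 i) (onesProb-slice₀ i) ⟩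
    fromℕ 1 + 0ℚ                                         ≡⟨ +-identityʳ (fromℕ 1) ⟩
    fromℕ 1                                              ∎
    where open ≡-Reasoning
  onesProb-slice (suc k) (suc j) (Fin.suc i) = begin
    onesProb {suc (suc k)} (slice (suc (suc j))) (Fin.suc i)
      ≡⟨ sumZ2-split {suc k} (λ b → slice (suc (suc j)) b * bitℚ (lookup b (Fin.suc i))) ⟩
    onesProb {suc k} (slice (suc (suc j))) i + onesProb (slice (suc j)) i  ≡⟨ cong₂ _+_ (onesProb-slice k (suc j) i) (onesProb-slice k j i) ⟩
    fromℕ (k C suc j) + fromℕ (k C j)                                      ≡⟨ +-comm (fromℕ (k C suc j)) (fromℕ (k C j)) ⟩
    fromℕ (k C j) + fromℕ (k C suc j)                                      ≡⟨ sym (fromℕ-+ (k C j) (k C suc j)) ⟩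
    fromℕ (k C j ℕ.+ k C suc j)                                            ≡⟨ cong fromℕ (nCk+nC[k+1]≡[n+1]C[k+1] k j) ⟩
    fromℕ (suc k C suc j)                                                  ∎
    where open ≡-Reasoning

  slice-double-count : ∀ k j → fromℕ (suc k) * fromℕ (k C j) ≡ fromℕ (suc k C suc j) * fromℕ (suc j)
  slice-double-count k j = begin
    fromℕ (suc k) * fromℕ (k C j)                  ≡⟨ sym (sum-const (suc k) (fromℕ (k C j))) ⟩
    sum {suc k} (λ _ → fromℕ (k C j))              ≡⟨ sum-cong-≗ (λ i → sym (onesProb-slice k j i)) ⟩
    sum (onesProb {suc k} (slice (suc j)))         ≡⟨ sym (𝔼-weight≡sum-onesProb {suc k} (slice (suc j))) ⟩
    𝔼 {suc k} (slice (suc j)) (fromℕ ∘ weight)     ≡⟨ 𝔼-slice {suc k} (λ b w≡j+1 → cong fromℕ w≡j+1) ⟩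
    sumZ2 {suc k} (slice (suc j)) * fromℕ (suc j)  ≡⟨ cong (_* fromℕ (suc j)) (∑-slice (suc k) (suc j)) ⟩
    fromℕ (suc k C suc j) * fromℕ (suc j)          ∎
    where open ≡-Reasoning

  0<fromℕ-C : ∀ {k j} → j ℕ.≤ k → 0ℚ < fromℕ (k C j)
  0<fromℕ-C {k} {j} j≤k with k C j | 0<C j≤k
  ... | suc c | _ = 0<fromℕ c

  uniformSlice : ∀ k j → j ℕ.≤ k → Vec Bool k → ℚ
  uniformSlice k j j≤k b = inv (fromℕ (k C j)) (0<fromℕ-C j≤k) * slice j b

  module _ {k j} (j≤k : j ℕ.≤ k) where

    private
      κ : ℚ
      κ = inv (fromℕ (k C j)) (0<fromℕ-C j≤k)

      C*κ≡1 : fromℕ (k C j) * κ ≡ 1ℚ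
      C*κ≡1 = *-inv (fromℕ (k C j)) (0<fromℕ-C j≤k)

    uniformSlice-isDist : IsDist (uniformSlice k j j≤k)
    uniformSlice-isDist =
      (λ b → *-nonNeg (<⇒≤ (inv-pos _ (0<fromℕ-C j≤k))) (slice-nonNeg b)) ,
      (begin
        sumZ2 (uniformSlice k j j≤k)  ≡⟨ sumZ2-*ˡ {k} κ (slice j) ⟩
        κ * sumZ2 {k} (slice j)       ≡⟨ cong (κ *_) (∑-slice k j) ⟩
        κ * fromℕ (k C j)             ≡⟨ *-comm κ _ ⟩
        fromℕ (k C j) * κ             ≡⟨ C*κ≡1 ⟩
        1ℚ                            ∎)
      where open ≡-Reasoning

    𝔼-uniformSlice : ∀ {g c} → (∀ b → weight b ≡ j → g b ≡ c) → 𝔼 (uniformSlice k j j≤k) g ≡ c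
    𝔼-uniformSlice {g} {c} g≡c = begin
      𝔼 (uniformSlice k j j≤k) g     ≡⟨ 𝔼-*ˡ {k} κ (slice j) g ⟩
      κ * 𝔼 {k} (slice j) g          ≡⟨ cong (κ *_) (𝔼-slice g≡c) ⟩
      κ * (sumZ2 {k} (slice j) * c)  ≡⟨ cong (λ x → κ * (x * c)) (∑-slice k j) ⟩
      κ * (fromℕ (k C j) * c)        ≡⟨ sym (*-assoc κ _ c) ⟩
      κ * fromℕ (k C j) * c          ≡⟨ cong (_* c) (trans (*-comm κ _) C*κ≡1) ⟩
      1ℚ * c                         ≡⟨ *-identityˡ c ⟩
      c                              ∎
      where open ≡-Reasoning

  onesProb-uniformSlice : ∀ {k j} (j<k : suc j ℕ.≤ suc k) i →
                          fromℕ (suc k) * onesProb (uniformSlice (suc k) (suc j) j<k) i ≡ fromℕ (suc j)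
  onesProb-uniformSlice {k} {j} j<k i = begin
    K * onesProb (uniformSlice (suc k) (suc j) j<k) i  ≡⟨ cong (K *_) (𝔼-*ˡ κ (slice (suc j)) (λ b → bitℚ (lookup b i))) ⟩
    K * (κ * onesProb (slice (suc j)) i)               ≡⟨ cong (λ x → K * (κ * x)) (onesProb-slice k j i) ⟩
    K * (κ * fromℕ (k C j))                            ≡⟨ x∙yz≈y∙xz K κ _ ⟩
    κ * (K * fromℕ (k C j))                            ≡⟨ cong (κ *_) (slice-double-count k j) ⟩
    κ * (C′ * fromℕ (suc j))                           ≡⟨ sym (*-assoc κ C′ _) ⟩
    κ * C′ * fromℕ (suc j)                             ≡⟨ cong (_* fromℕ (suc j)) (trans (*-comm κ C′) (*-inv C′ (0<fromℕ-C j<k))) ⟩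
    1ℚ * fromℕ (suc j)                                 ≡⟨ *-identityˡ _ ⟩
    fromℕ (suc j)                                      ∎
    where
    open ≡-Reasoning
    K = fromℕ (suc k)
    C′ = fromℕ (suc k C suc j)
    κ = inv C′ (0<fromℕ-C j<k)

  -- λ for kAND, and the two halves of α(kAND) = c

  kAND⇒weight≡k : ∀ {k} (b : Vec Bool k) → kAND k b ≡ true → weight b ≡ k
  kAND⇒weight≡k [] _ = refl
  kAND⇒weight≡k (true ∷ b) kAND≡true = cong suc (kAND⇒weight≡k b kAND≡true)

  weight≡k⇒kAND : ∀ {k} (b : Vec Bool k) → weight b ≡ k → kAND k b ≡ true
  weight≡k⇒kAND [] _ = refl
  weight≡k⇒kAND (true ∷ b) w≡k = weight≡k⇒kAND b (ℕₚ.suc-injective w≡k)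
  weight≡k⇒kAND {suc k} (false ∷ b) w≡k = contradiction (subst (ℕ._≤ k) w≡k (weight≤ b)) ℕₚ.1+n≰n
    where
    weight≤ : ∀ {k} (b : Vec Bool k) → weight b ℕ.≤ k
    weight≤ b = subst (weight b ℕ.≤_) (weight+zeros b) (ℕₚ.m≤m+n (weight b) (zeros b))

  weight≡0⇒¬kAND : ∀ {k} (b : Vec Bool (suc k)) → weight b ≡ 0 → kAND (suc k) b ≡ false
  weight≡0⇒¬kAND (false ∷ b) _ = refl

  kANDProb : ∀ {k} → ℚ → Vec Bool k → ℚ
  kANDProb p b = p ^ℚ weight b * (1ℚ - p) ^ℚ zeros b

  bern-kAND-xor : ∀ {k} p (b : Vec Bool k) →
                  sumZ2 (λ a → bernProb p a * bitℚ (kAND k (zipWith _xor_ a b))) ≡ kANDProb p b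
  bern-kAND-xor p [] = refl
  bern-kAND-xor {suc k} p (true ∷ b) = begin
    sumZ2 {suc k} (λ a → bernProb p a * bitℚ (kAND (suc k) (zipWith _xor_ a (true ∷ b))))
      ≡⟨ sumZ2-split {k} (λ a → bernProb p a * bitℚ (kAND (suc k) (zipWith _xor_ a (true ∷ b)))) ⟩
    𝔼 {k} (λ a → p * bernProb p a) (λ a → bitℚ (kAND k (zipWith _xor_ a b))) + 𝔼 {k} (λ a → (1ℚ - p) * bernProb p a) (λ _ → 0ℚ)
      ≡⟨ cong₂ _+_ (trans (𝔼-*ˡ {k} p (bernProb p) _) (cong (p *_) (bern-kAND-xor p b))) (𝔼-0 {k} (λ a → (1ℚ - p) * bernProb p a)) ⟩
    p * kANDProb p b + 0ℚ
      ≡⟨ regroup p (p ^ℚ weight b) ((1ℚ - p) ^ℚ zeros b) ⟩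
    kANDProb p (true ∷ b)  ∎
    where
    open ≡-Reasoning
    regroup : ∀ p x y → p * (x * y) + 0ℚ ≡ p * x * y
    regroup = solve-∀ ℚ-ring
  bern-kAND-xor {suc k} p (false ∷ b) = begin
    sumZ2 {suc k} (λ a → bernProb p a * bitℚ (kAND (suc k) (zipWith _xor_ a (false ∷ b))))
      ≡⟨ sumZ2-split {k} (λ a → bernProb p a * bitℚ (kAND (suc k) (zipWith _xor_ a (false ∷ b)))) ⟩
    𝔼 {k} (λ a → p * bernProb p a) (λ _ → 0ℚ) + 𝔼 {k} (λ a → (1ℚ - p) * bernProb p a) (λ a → bitℚ (kAND k (zipWith _xor_ a b)))
      ≡⟨ cong₂ _+_ (𝔼-0 {k} (λ a → p * bernProb p a)) (trans (𝔼-*ˡ {k} (1ℚ - p) (bernProb p) _) (cong ((1ℚ - p) *_) (bern-kAND-xor p b))) ⟩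
    0ℚ + (1ℚ - p) * kANDProb p b
      ≡⟨ regroup (1ℚ - p) (p ^ℚ weight b) ((1ℚ - p) ^ℚ zeros b) ⟩
    kANDProb p (false ∷ b)  ∎
    where
    open ≡-Reasoning
    regroup : ∀ q x y → 0ℚ + q * (x * y) ≡ x * (q * y)
    regroup = solve-∀ ℚ-ring

  lam-kAND : ∀ {k} (D : Vec Bool k → ℚ) p → lam (kAND k) D p ≡ 𝔼 D (kANDProb p)
  lam-kAND D p = 𝔼-cong D (bern-kAND-xor p)

  kAND≤weight : ∀ {k} (b : Vec Bool k) → fromℕ k * bitℚ (kAND k b) ≤ fromℕ (weight b)
  kAND≤weight {k} b with kAND k b in kAND≡
  ... | true = ≤-reflexive (trans (*-identityʳ (fromℕ k)) (cong fromℕ (sym (kAND⇒weight≡k b kAND≡))))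
  ... | false = subst (_≤ fromℕ (weight b)) (sym (*-zeroʳ (fromℕ k))) (0≤fromℕ (weight b))

  alphaLower-kAND : ∀ {k} c P → 0ℚ ≤ c → 0ℚ ≤ P → P ≤ 1ℚ →
                    (∀ (b : Vec Bool (suc k)) → c * fromℕ (weight b) ≤ fromℕ (suc k) * kANDProb P b) →
                    AlphaLower (kAND (suc k)) c
  alphaLower-kAND {k} c P 0≤c 0≤P P≤1 pointwise DN DY (0≤DN , ∑DN≡1) (0≤DY , ∑DY≡1) marg≡ ε 0<ε =
    P , 0≤P , P≤1 , <-≤-trans (p-ε<p (c * γ) 0<ε) (*-cancelˡ-≤ (0<fromℕ k) chain)
    where
    open ≤-Reasoning
    K = fromℕ (suc k)
    γ = gam (kAND (suc k)) DY
    p-ε<p : ∀ p {ε} → 0ℚ < ε → p - ε < p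
    p-ε<p p {ε} 0<ε = begin-strict
      p - ε   <⟨ +-monoʳ-< p (neg-antimono-< 0<ε) ⟩
      p - 0ℚ  ≡⟨ +-identityʳ p ⟩
      p       ∎
    same-weights : 𝔼 DY (fromℕ ∘ weight) ≡ 𝔼 DN (fromℕ ∘ weight)
    same-weights = begin-equality
      𝔼 DY (fromℕ ∘ weight)  ≡⟨ 𝔼-weight≡sum-onesProb DY ⟩
      sum (onesProb DY)      ≡⟨ sum-cong-≗ (λ i → same-marg⇒same-onesProb DY DN i (trans ∑DY≡1 (sym ∑DN≡1)) (sym (marg≡ i))) ⟩
      sum (onesProb DN)      ≡⟨ sym (𝔼-weight≡sum-onesProb DN) ⟩
      𝔼 DN (fromℕ ∘ weight)  ∎
    chain : K * (c * γ) ≤ K * lam (kAND (suc k)) DN P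
    chain = begin
      K * (c * γ)                                 ≡⟨ x∙yz≈y∙xz K c γ ⟩
      c * (K * γ)                                 ≡⟨ cong (c *_) (sym (𝔼-*ʳ DY K (bitℚ ∘ kAND (suc k)))) ⟩
      c * 𝔼 DY (λ b → K * bitℚ (kAND (suc k) b))  ≤⟨ *-monoˡ-≤ 0≤c (𝔼-mono 0≤DY kAND≤weight) ⟩
      c * 𝔼 DY (fromℕ ∘ weight)                   ≡⟨ cong (c *_) same-weights ⟩
      c * 𝔼 DN (fromℕ ∘ weight)                   ≡⟨ sym (𝔼-*ʳ DN c (fromℕ ∘ weight)) ⟩
      𝔼 DN (λ b → c * fromℕ (weight b))           ≤⟨ 𝔼-mono 0≤DN pointwise ⟩
      𝔼 DN (λ b → K * kANDProb P b)               ≡⟨ 𝔼-*ʳ DN K (kANDProb P) ⟩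
      K * 𝔼 DN (kANDProb P)                       ≡⟨ cong (K *_) (sym (lam-kAND DN P)) ⟩
      K * lam (kAND (suc k)) DN P                 ∎

  module _ {k : ℕ} where

    allOnes allZeros : Vec Bool (suc k) → ℚ
    allOnes = uniformSlice (suc k) (suc k) ℕₚ.≤-refl
    allZeros = uniformSlice (suc k) 0 ℕ.z≤n

    allOrNothing : ℚ → Vec Bool (suc k) → ℚ
    allOrNothing t = mix t allOnes allZeros

    private
      t·1+[1-t]·0 : ∀ t → t * 1ℚ + (1ℚ - t) * 0ℚ ≡ t
      t·1+[1-t]·0 = solve-∀ ℚ-ring

    allOrNothing-isDist : ∀ {t} → 0ℚ ≤ t → t ≤ 1ℚ → IsDist (allOrNothing t)
    allOrNothing-isDist 0≤t t≤1 = mix-isDist 0≤t t≤1 (uniformSlice-isDist {suc k} ℕₚ.≤-refl) (uniformSlice-isDist {suc k} ℕ.z≤n)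

    onesProb-allOrNothing : ∀ t i → onesProb (allOrNothing t) i ≡ t
    onesProb-allOrNothing t i = begin
      onesProb (allOrNothing t) i                              ≡⟨ 𝔼-mix t allOnes allZeros (λ b → bitℚ (lookup b i)) ⟩
      t * onesProb allOnes i + (1ℚ - t) * onesProb allZeros i  ≡⟨ cong₂ (λ x y → t * x + (1ℚ - t) * y) on-ones on-zeros ⟩
      t * 1ℚ + (1ℚ - t) * 0ℚ                                   ≡⟨ t·1+[1-t]·0 t ⟩
      t                                                        ∎
      where
      open ≡-Reasoning
      on-ones : onesProb allOnes i ≡ 1ℚ
      on-ones = *-cancelˡ-≡ (0<fromℕ k) (trans (onesProb-uniformSlice {k} ℕₚ.≤-refl i) (sym (*-identityʳ (fromℕ (suc k)))))
      on-zeros : onesProb allZeros i ≡ 0ℚ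
      on-zeros = 𝔼-uniformSlice {suc k} ℕ.z≤n (λ b w≡0 → cong bitℚ (weight≡0⇒lookup≡false b i w≡0))

    gam-allOrNothing : ∀ t → gam (kAND (suc k)) (allOrNothing t) ≡ t
    gam-allOrNothing t = begin
      gam (kAND (suc k)) (allOrNothing t)                                      ≡⟨ 𝔼-mix t allOnes allZeros (bitℚ ∘ kAND (suc k)) ⟩
      t * gam (kAND (suc k)) allOnes + (1ℚ - t) * gam (kAND (suc k)) allZeros  ≡⟨ cong₂ (λ x y → t * x + (1ℚ - t) * y) on-ones on-zeros ⟩
      t * 1ℚ + (1ℚ - t) * 0ℚ                                                   ≡⟨ t·1+[1-t]·0 t ⟩
      t                                                                        ∎
      where
      open ≡-Reasoning
      on-ones : gam (kAND (suc k)) allOnes ≡ 1ℚ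
      on-ones = 𝔼-uniformSlice {suc k} ℕₚ.≤-refl (λ b w≡k → cong bitℚ (weight≡k⇒kAND b w≡k))
      on-zeros : gam (kAND (suc k)) allZeros ≡ 0ℚ
      on-zeros = 𝔼-uniformSlice {suc k} ℕ.z≤n (λ b w≡0 → cong bitℚ (weight≡0⇒¬kAND b w≡0))

  alphaUpper-kAND : ∀ {k} (DN : Vec Bool (suc k) → ℚ) {t c} → IsDist DN → 0ℚ < t → t ≤ 1ℚ →
                    (∀ i → onesProb DN i ≡ t) →
                    (∀ p → 0ℚ ≤ p → p ≤ 1ℚ → lam (kAND (suc k)) DN p ≤ c * t) →
                    AlphaUpper (kAND (suc k)) c
  alphaUpper-kAND {k} DN {t} {c} DN-dist@(_ , ∑DN≡1) 0<t t≤1 onesN≡t lam≤ct ε 0<ε =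
    DN , DY , DN-dist , DY-dist , same-marg , subst (0ℚ <_) (sym (gam-allOrNothing {k} t)) 0<t , bound
    where
    DY : Vec Bool (suc k) → ℚ
    DY = allOrNothing t
    DY-dist : IsDist DY
    DY-dist = allOrNothing-isDist (<⇒≤ 0<t) t≤1

    same-marg : ∀ i → marg DN i ≡ marg DY i
    same-marg i = same-onesProb⇒same-marg DN DY i (trans ∑DN≡1 (sym (proj₂ DY-dist)))
                                          (trans (onesN≡t i) (sym (onesProb-allOrNothing {k} t i)))

    bound : ∀ p → 0ℚ ≤ p → p ≤ 1ℚ → lam (kAND (suc k)) DN p ≤ (c + ε) * gam (kAND (suc k)) DY
    bound p 0≤p p≤1 = begin
      lam (kAND (suc k)) DN p          ≤⟨ lam≤ct p 0≤p p≤1 ⟩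
      c * t                            ≤⟨ *-monoʳ-≤-nonNeg t {{nonNegative (<⇒≤ 0<t)}} (p≤p+q c (<⇒≤ 0<ε)) ⟩
      (c + ε) * t                      ≡⟨ cong ((c + ε) *_) (sym (gam-allOrNothing {k} t)) ⟩
      (c + ε) * gam (kAND (suc k)) DY  ∎
      where open ≤-Reasoning

  -- AM–GM and the optimal bias

  -- AM–GM for n copies of x and one copy of (n+1)y − nx, whose mean is y.
  amgm : ∀ n {x y} → 0ℚ ≤ x → 0ℚ ≤ y → x ^ℚ n * (fromℕ (suc n) * y - fromℕ n * x) ≤ y ^ℚ suc n
  amgm zero {x} {y} _ _ = ≤-reflexive (base x y)
    where
    base : ∀ x y → 1ℚ * ((1ℚ + 0ℚ) * y - 0ℚ * x) ≡ y * 1ℚ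
    base = solve-∀ ℚ-ring
  amgm (suc n) {x} {y} 0≤x 0≤y = begin
    x ^ℚ suc n * (fromℕ (suc (suc n)) * y - fromℕ (suc n) * x)        ≤⟨ p≤p+q _ gap≥0 ⟩
    x ^ℚ suc n * (fromℕ (suc (suc n)) * y - fromℕ (suc n) * x) + gap  ≡⟨ expand x y (x ^ℚ n) (y ^ℚ n) (fromℕ n) ⟩
    y ^ℚ suc (suc n)                                                  ∎
    where
    open ≤-Reasoning
    slack = y ^ℚ suc n - x ^ℚ n * (fromℕ (suc n) * y - fromℕ n * x)
    gap = y * slack + fromℕ (suc n) * x ^ℚ n * ((x - y) * (x - y))
    gap≥0 : 0ℚ ≤ gap
    gap≥0 = +-nonNeg (*-nonNeg 0≤y (0≤q-p (amgm n 0≤x 0≤y)))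
                     (*-nonNeg (*-nonNeg (0≤fromℕ (suc n)) (^ℚ-nonNeg n 0≤x)) (sq-nonNeg (x - y)))
    expand : ∀ x y X Y N →
             x * X * ((1ℚ + (1ℚ + N)) * y - (1ℚ + N) * x)
               + (y * (y * Y - X * ((1ℚ + N) * y - N * x)) + (1ℚ + N) * X * ((x - y) * (x - y)))
             ≡ y * (y * Y)
    expand = solve-∀ ℚ-ring

  tangent-bound : ∀ n {x y a L} → 0ℚ ≤ x → 0ℚ < y → 0ℚ ≤ L →
                  a * y ≤ L * (fromℕ (suc n) * y - fromℕ n * x) → x ^ℚ n * a ≤ y ^ℚ n * L
  tangent-bound n {x} {y} {a} {L} 0≤x 0<y 0≤L ay≤LZ = *-cancelˡ-≤ 0<y (begin
    y * (x ^ℚ n * a)  ≡⟨ x∙yz≈y∙xz y (x ^ℚ n) a ⟩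
    x ^ℚ n * (y * a)  ≡⟨ cong (x ^ℚ n *_) (*-comm y a) ⟩
    x ^ℚ n * (a * y)  ≤⟨ *-monoˡ-≤ (^ℚ-nonNeg n 0≤x) ay≤LZ ⟩
    x ^ℚ n * (L * Z)  ≡⟨ x∙yz≈y∙xz (x ^ℚ n) L Z ⟩
    L * (x ^ℚ n * Z)  ≤⟨ *-monoˡ-≤ 0≤L (amgm n 0≤x (<⇒≤ 0<y)) ⟩
    L * (y * y ^ℚ n)  ≡⟨ x∙yz≈y∙xz L y (y ^ℚ n) ⟩
    y * (L * y ^ℚ n)  ≡⟨ cong (y *_) (*-comm L (y ^ℚ n)) ⟩
    y * (y ^ℚ n * L)  ∎)
    where
    open ≤-Reasoning
    Z = fromℕ (suc n) * y - fromℕ n * x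

  -- P = (m+1)/(2m+1) maximises p^(m+1) (1−p)^m on [0,1].
  module OptimalBias (n : ℕ) where

    m : ℕ
    m = suc n

    M s : ℚ
    M = fromℕ m
    s = 1ℚ + (M + M)

    fromℕ-2m : fromℕ (m ℕ.* 2) ≡ M + M
    fromℕ-2m = trans (fromℕ-* m 2) (double M)
      where
      double : ∀ M → M * (1ℚ + (1ℚ + 0ℚ)) ≡ M + M
      double = solve-∀ ℚ-ring

    fromℕ-2m+1 : fromℕ (suc (m ℕ.* 2)) ≡ s
    fromℕ-2m+1 = cong (1ℚ +_) fromℕ-2m

    0<s : 0ℚ < s
    0<s = subst (0ℚ <_) fromℕ-2m+1 (0<fromℕ (m ℕ.* 2))

    r : ℚ
    r = inv s 0<s

    s*r≡1 : s * r ≡ 1ℚ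
    s*r≡1 = *-inv s 0<s

    P Q : ℚ
    P = fromℕ (suc m) * r
    Q = 1ℚ - P

    s*P≡1+M : s * P ≡ 1ℚ + M
    s*P≡1+M = trans (x∙yz≈y∙xz s (1ℚ + M) r) (trans (cong ((1ℚ + M) *_) s*r≡1) (*-identityʳ (1ℚ + M)))

    Q≡M*r : Q ≡ M * r
    Q≡M*r = trans (cong (_- P) (sym s*r≡1)) (cancel M r)
      where
      cancel : ∀ M r → (1ℚ + (M + M)) * r - (1ℚ + M) * r ≡ M * r
      cancel = solve-∀ ℚ-ring

    s*Q≡M : s * Q ≡ M
    s*Q≡M = trans (cong (s *_) Q≡M*r) (trans (x∙yz≈y∙xz s M r) (trans (cong (M *_) s*r≡1) (*-identityʳ M)))

    0<P : 0ℚ < P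
    0<P = *-pos (0<fromℕ m) (inv-pos s 0<s)

    0≤Q : 0ℚ ≤ Q
    0≤Q = subst (0ℚ ≤_) (sym Q≡M*r) (*-nonNeg (0≤fromℕ m) (<⇒≤ (inv-pos s 0<s)))

    0<PQ : 0ℚ < P * Q
    0<PQ = *-pos 0<P (subst (0ℚ <_) (sym Q≡M*r) (*-pos (0<fromℕ n) (inv-pos s 0<s)))

    P≤1 : P ≤ 1ℚ
    P≤1 = subst (P ≤_) (P+[1-P]≡1 P) (p≤p+q P 0≤Q)
      where
      P+[1-P]≡1 : ∀ P → P + (1ℚ - P) ≡ 1ℚ
      P+[1-P]≡1 = solve-∀ ℚ-ring

    P^j*Q^l : ∀ j l → P ^ℚ j * Q ^ℚ l ≡ fromℕ (suc m ℕ.^ j ℕ.* m ℕ.^ l) * r ^ℚ (j ℕ.+ l)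
    P^j*Q^l j l = begin
      P ^ℚ j * Q ^ℚ l                                   ≡⟨ cong (λ q → P ^ℚ j * q ^ℚ l) Q≡M*r ⟩
      P ^ℚ j * (M * r) ^ℚ l                             ≡⟨ cong₂ _*_ (^ℚ-* (fromℕ (suc m)) r j) (^ℚ-* M r l) ⟩
      fromℕ (suc m) ^ℚ j * r ^ℚ j * (M ^ℚ l * r ^ℚ l)   ≡⟨ interchange (fromℕ (suc m) ^ℚ j) (r ^ℚ j) (M ^ℚ l) (r ^ℚ l) ⟩
      fromℕ (suc m) ^ℚ j * M ^ℚ l * (r ^ℚ j * r ^ℚ l)   ≡⟨ sym (cong₂ _*_ powers (^ℚ-+ r j l)) ⟩
      fromℕ (suc m ℕ.^ j ℕ.* m ℕ.^ l) * r ^ℚ (j ℕ.+ l)  ∎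
      where
      open ≡-Reasoning
      interchange : ∀ a b c d → a * b * (c * d) ≡ a * c * (b * d)
      interchange = solve-∀ ℚ-ring
      powers : fromℕ (suc m ℕ.^ j ℕ.* m ℕ.^ l) ≡ fromℕ (suc m) ^ℚ j * M ^ℚ l
      powers = trans (fromℕ-* (suc m ℕ.^ j) (m ℕ.^ l)) (cong₂ _*_ (fromℕ-^ (suc m) j) (fromℕ-^ m l))

    [PQ]^m*j≤s*P^j*Q^l : ∀ j l → j ℕ.+ l ≡ suc (m ℕ.* 2) → (P * Q) ^ℚ m * fromℕ j ≤ s * (P ^ℚ j * Q ^ℚ l)
    [PQ]^m*j≤s*P^j*Q^l j l j+l≡2m+1 = begin
      (P * Q) ^ℚ m * fromℕ j              ≡⟨ cong (_* fromℕ j) (trans (^ℚ-* P Q m) (P^j*Q^l m m)) ⟩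
      fromℕ A * R * fromℕ j               ≡⟨ swap (fromℕ A) R (fromℕ j) ⟩
      fromℕ A * fromℕ j * R               ≡⟨ cong (_* R) (sym (fromℕ-* A j)) ⟩
      fromℕ (A ℕ.* j) * R                 ≤⟨ *-monoʳ-≤-nonNeg R {{nonNegative 0≤R}} (fromℕ-mono-≤ (middle-bound m j l j+l≡2m+1)) ⟩
      fromℕ B * R                         ≡⟨ sym (absorb-s (fromℕ B)) ⟩
      s * (fromℕ B * r ^ℚ suc (m ℕ.+ m))  ≡⟨ cong (λ e → s * (fromℕ B * r ^ℚ e)) (trans (cong suc (m+m≡m*2 m)) (sym j+l≡2m+1)) ⟩
      s * (fromℕ B * r ^ℚ (j ℕ.+ l))      ≡⟨ cong (s *_) (sym (P^j*Q^l j l)) ⟩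
      s * (P ^ℚ j * Q ^ℚ l)               ∎
      where
      open ≤-Reasoning
      A = suc m ℕ.^ m ℕ.* m ℕ.^ m
      B = suc m ℕ.^ j ℕ.* m ℕ.^ l
      R = r ^ℚ (m ℕ.+ m)
      0≤R : 0ℚ ≤ R
      0≤R = ^ℚ-nonNeg (m ℕ.+ m) (<⇒≤ (inv-pos s 0<s))
      swap : ∀ a b c → a * b * c ≡ a * c * b
      swap = solve-∀ ℚ-ring
      regroup : ∀ s r b R → s * (b * (r * R)) ≡ s * r * (b * R)
      regroup = solve-∀ ℚ-ring
      absorb-s : ∀ b → s * (b * (r * R)) ≡ b * R
      absorb-s b = trans (regroup s r b R) (trans (cong (_* (b * R)) s*r≡1) (*-identityˡ (b * R)))

    alpha'≡[PQ]^m : alpha' (suc (m ℕ.* 2)) ≡ (P * Q) ^ℚ m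
    alpha'≡[PQ]^m = trans (cong (base ^ℚ_) (m*n/n≡m m 2)) (cong (_^ℚ m) base≡PQ)
      where
      ℓ = m ℕ.* 2
      d d-1 : ℕ
      d = 4 ℕ.* (suc ℓ ℕ.* suc ℓ)
      d-1 = ℓ ℕ.+ ℓ ℕ.* suc ℓ ℕ.+ 3 ℕ.* (suc ℓ ℕ.* suc ℓ)
      base = (ℤ.+ (ℓ ℕ.* (ℓ ℕ.+ 2))) / d
      0<d : 0ℚ < fromℕ d
      0<d = 0<fromℕ d-1
      numerator≡ : fromℕ (ℓ ℕ.* (ℓ ℕ.+ 2)) ≡ (M + M) * ((M + M) + (1ℚ + (1ℚ + 0ℚ)))
      numerator≡ = trans (fromℕ-* ℓ (ℓ ℕ.+ 2)) (cong₂ _*_ fromℕ-2m (trans (fromℕ-+ ℓ 2) (cong (_+ fromℕ 2) fromℕ-2m)))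
      d≡ : fromℕ d ≡ fromℕ 4 * (s * s)
      d≡ = trans (fromℕ-* 4 (suc ℓ ℕ.* suc ℓ)) (cong (fromℕ 4 *_) (trans (fromℕ-* (suc ℓ) (suc ℓ)) (cong₂ _*_ fromℕ-2m+1 fromℕ-2m+1)))
      expand : ∀ M r s → (1ℚ + (1ℚ + (1ℚ + (1ℚ + 0ℚ)))) * (s * s) * ((1ℚ + M) * r * (M * r))
                         ≡ s * r * (s * r) * ((M + M) * ((M + M) + (1ℚ + (1ℚ + 0ℚ))))
      expand = solve-∀ ℚ-ring
      d*PQ : fromℕ d * (P * Q) ≡ fromℕ (ℓ ℕ.* (ℓ ℕ.+ 2))
      d*PQ = begin
        fromℕ d * (P * Q)                                  ≡⟨ cong₂ (λ x q → x * (P * q)) d≡ Q≡M*r ⟩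
        fromℕ 4 * (s * s) * (P * (M * r))                  ≡⟨ expand M r s ⟩
        s * r * (s * r) * ((M + M) * ((M + M) + fromℕ 2))  ≡⟨ cong (λ x → x * x * ((M + M) * ((M + M) + fromℕ 2))) s*r≡1 ⟩
        1ℚ * 1ℚ * ((M + M) * ((M + M) + fromℕ 2))          ≡⟨ *-identityˡ _ ⟩
        (M + M) * ((M + M) + fromℕ 2)                      ≡⟨ sym numerator≡ ⟩
        fromℕ (ℓ ℕ.* (ℓ ℕ.+ 2))                            ∎
        where open ≡-Reasoning
      base≡PQ : base ≡ P * Q
      base≡PQ = *-cancelˡ-≡ 0<d (trans (*-comm (fromℕ d) _) (trans (/-*-cancel (ℓ ℕ.* (ℓ ℕ.+ 2)) d-1) (sym d*PQ)))

  module OddCase (n : ℕ) where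

    open OptimalBias n

    k : ℕ
    k = suc (m ℕ.* 2)

    m+1≤k : suc m ℕ.≤ k
    m+1≤k = ℕ.s≤s (ℕₚ.m≤m*n m 2)

    DN : Vec Bool k → ℚ
    DN = uniformSlice k (suc m) m+1≤k

    onesProb-DN : ∀ i → onesProb DN i ≡ P
    onesProb-DN i = *-cancelˡ-≡ 0<s (begin
      s * onesProb DN i        ≡⟨ cong (_* onesProb DN i) (sym fromℕ-2m+1) ⟩
      fromℕ k * onesProb DN i  ≡⟨ onesProb-uniformSlice m+1≤k i ⟩
      1ℚ + M                   ≡⟨ sym s*P≡1+M ⟩
      s * P                    ∎)
      where open ≡-Reasoning

    lam-DN : ∀ p → lam (kAND k) DN p ≡ p ^ℚ suc m * (1ℚ - p) ^ℚ m
    lam-DN p = trans (lam-kAND DN p) (𝔼-uniformSlice m+1≤k (λ b w≡m+1 →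
      cong₂ (λ j l → p ^ℚ j * (1ℚ - p) ^ℚ l) w≡m+1 (weight≡⇒zeros≡ b w≡m+1 (cong suc (m+m≡m*2 m)))))

    tangent-condition : ∀ p → p * (P * Q) ≤ P * (fromℕ (suc m) * (P * Q) - fromℕ m * (p * (1ℚ - p)))
    tangent-condition p = begin
      p * (P * Q)                                                                     ≤⟨ p≤p+q _ (*-nonNeg (<⇒≤ 0<P) (*-nonNeg (0≤fromℕ m) (sq-nonNeg (p - P)))) ⟩
      p * (P * Q) + P * (M * ((p - P) * (p - P)))                                     ≡⟨ sym (drop-zero-term {y = P * (p - P)} (p≡q⇒p-q≡0 s*P≡1+M)) ⟩
      p * (P * Q) + P * (M * ((p - P) * (p - P))) + P * (p - P) * (s * P - (1ℚ + M))  ≡⟨ sym (expand M P p) ⟩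
      P * (fromℕ (suc m) * (P * Q) - fromℕ m * (p * (1ℚ - p)))                        ∎
      where
      open ≤-Reasoning
      expand : ∀ M P p → P * ((1ℚ + M) * (P * (1ℚ - P)) - M * (p * (1ℚ - p)))
                         ≡ p * (P * (1ℚ - P)) + P * (M * ((p - P) * (p - P)))
                           + P * (p - P) * ((1ℚ + (M + M)) * P - (1ℚ + M))
      expand = solve-∀ ℚ-ring

    lam-DN-bound : ∀ p → 0ℚ ≤ p → p ≤ 1ℚ → p ^ℚ suc m * (1ℚ - p) ^ℚ m ≤ (P * Q) ^ℚ m * P
    lam-DN-bound p 0≤p p≤1 = begin
      p * p ^ℚ m * (1ℚ - p) ^ℚ m  ≡⟨ regroup p (p ^ℚ m) ((1ℚ - p) ^ℚ m) ⟩
      p ^ℚ m * (1ℚ - p) ^ℚ m * p  ≡⟨ cong (_* p) (sym (^ℚ-* p (1ℚ - p) m)) ⟩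
      (p * (1ℚ - p)) ^ℚ m * p     ≤⟨ tangent-bound m (*-nonNeg 0≤p (0≤q-p p≤1)) 0<PQ (<⇒≤ 0<P) (tangent-condition p) ⟩
      (P * Q) ^ℚ m * P            ∎
      where
      open ≤-Reasoning
      regroup : ∀ p a b → p * a * b ≡ a * b * p
      regroup = solve-∀ ℚ-ring

    alpha-odd : AlphaIs (kAND k) (alpha' k)
    alpha-odd = subst (AlphaIs (kAND k)) (sym alpha'≡[PQ]^m) (lower , upper)
      where
      lower : AlphaLower (kAND k) ((P * Q) ^ℚ m)
      lower = alphaLower-kAND ((P * Q) ^ℚ m) P (^ℚ-nonNeg m (<⇒≤ 0<PQ)) (<⇒≤ 0<P) P≤1 (λ b →
        subst (λ K → (P * Q) ^ℚ m * fromℕ (weight b) ≤ K * kANDProb P b) (sym fromℕ-2m+1)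
              ([PQ]^m*j≤s*P^j*Q^l (weight b) (zeros b) (weight+zeros b)))
      upper : AlphaUpper (kAND k) ((P * Q) ^ℚ m)
      upper = alphaUpper-kAND DN {P} {(P * Q) ^ℚ m} (uniformSlice-isDist m+1≤k) 0<P P≤1 onesProb-DN (λ p 0≤p p≤1 →
        subst (_≤ (P * Q) ^ℚ m * P) (sym (lam-DN p)) (lam-DN-bound p 0≤p p≤1))

  module EvenCase (n : ℕ) where

    open OptimalBias n

    k : ℕ
    k = m ℕ.* 2

    N D : ℚ
    N = fromℕ n
    D = M * M + (1ℚ + M) * (1ℚ + M)

    0<M : 0ℚ < M
    0<M = 0<fromℕ n

    0<D : 0ℚ < D
    0<D = +-mono-<-≤ (*-pos 0<M 0<M) (sq-nonNeg (1ℚ + M))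

    0<2M : 0ℚ < M + M
    0<2M = +-mono-< 0<M 0<M

    -- The mixing weight m²/(m² + (m+1)²) is the one that makes the quadratic in tangent-gap a perfect square.
    w t : ℚ
    w = M * M * inv D 0<D
    t = (M + w) * inv (M + M) 0<2M

    D*w≡M² : D * w ≡ M * M
    D*w≡M² = trans (x∙yz≈y∙xz D (M * M) _) (trans (cong (M * M *_) (*-inv D 0<D)) (*-identityʳ (M * M)))

    2M*t≡M+w : (M + M) * t ≡ M + w
    2M*t≡M+w = trans (x∙yz≈y∙xz (M + M) (M + w) _) (trans (cong ((M + w) *_) (*-inv (M + M) 0<2M)) (*-identityʳ (M + w)))

    0≤w : 0ℚ ≤ w
    0≤w = *-nonNeg (sq-nonNeg M) (<⇒≤ (inv-pos D 0<D))

    w≤1 : w ≤ 1ℚ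
    w≤1 = *-cancelˡ-≤ 0<D (begin
      D * w   ≡⟨ D*w≡M² ⟩
      M * M   ≤⟨ p≤p+q (M * M) (sq-nonNeg (1ℚ + M)) ⟩
      D       ≡⟨ sym (*-identityʳ D) ⟩
      D * 1ℚ  ∎)
      where open ≤-Reasoning

    0<t : 0ℚ < t
    0<t = *-pos (+-mono-<-≤ 0<M 0≤w) (inv-pos (M + M) 0<2M)

    t≤1 : t ≤ 1ℚ
    t≤1 = *-cancelˡ-≤ 0<2M (begin
      (M + M) * t   ≡⟨ 2M*t≡M+w ⟩
      M + w         ≤⟨ +-monoʳ-≤ M (≤-trans w≤1 (fromℕ-mono-≤ {1} {m} (ℕ.s≤s ℕ.z≤n))) ⟩
      M + M         ≡⟨ sym (*-identityʳ (M + M)) ⟩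
      (M + M) * 1ℚ  ∎)
      where open ≤-Reasoning

    m≤k : m ℕ.≤ k
    m≤k = ℕₚ.m≤m*n m 2

    m+1≤k : suc m ℕ.≤ k
    m+1≤k = ℕ.s≤s (ℕ.s≤s (ℕₚ.m≤m*n n 2))

    upper-slice lower-slice DN : Vec Bool k → ℚ
    upper-slice = uniformSlice k (suc m) m+1≤k
    lower-slice = uniformSlice k m m≤k
    DN = mix w upper-slice lower-slice

    DN-isDist : IsDist DN
    DN-isDist = mix-isDist 0≤w w≤1 (uniformSlice-isDist m+1≤k) (uniformSlice-isDist m≤k)

    onesProb-DN : ∀ i → onesProb DN i ≡ t
    onesProb-DN i = *-cancelˡ-≡ 0<2M (begin
      (M + M) * onesProb DN i
        ≡⟨ cong ((M + M) *_) (𝔼-mix w upper-slice lower-slice (λ b → bitℚ (lookup b i))) ⟩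
      (M + M) * (w * onesProb upper-slice i + (1ℚ - w) * onesProb lower-slice i)
        ≡⟨ distribute (M + M) w (onesProb upper-slice i) (onesProb lower-slice i) ⟩
      w * ((M + M) * onesProb upper-slice i) + (1ℚ - w) * ((M + M) * onesProb lower-slice i)
        ≡⟨ cong₂ (λ a b → w * a + (1ℚ - w) * b) (scaled m+1≤k) (scaled m≤k) ⟩
      w * (1ℚ + M) + (1ℚ - w) * M  ≡⟨ collect M w ⟩
      M + w                        ≡⟨ sym 2M*t≡M+w ⟩
      (M + M) * t                  ∎)
      where
      open ≡-Reasoning
      distribute : ∀ c w a b → c * (w * a + (1ℚ - w) * b) ≡ w * (c * a) + (1ℚ - w) * (c * b)
      distribute = solve-∀ ℚ-ring
      collect : ∀ M w → w * (1ℚ + M) + (1ℚ - w) * M ≡ M + w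
      collect = solve-∀ ℚ-ring
      scaled : ∀ {j} (j<k : suc j ℕ.≤ k) → (M + M) * onesProb (uniformSlice k (suc j) j<k) i ≡ fromℕ (suc j)
      scaled {j} j<k = trans (cong (_* onesProb (uniformSlice k (suc j) j<k) i) (sym fromℕ-2m)) (onesProb-uniformSlice j<k i)

    lam-DN : ∀ p → lam (kAND k) DN p ≡ w * (p ^ℚ suc m * (1ℚ - p) ^ℚ n) + (1ℚ - w) * (p ^ℚ m * (1ℚ - p) ^ℚ m)
    lam-DN p = trans (lam-kAND DN p) (trans (𝔼-mix w upper-slice lower-slice (kANDProb p))
      (cong₂ (λ a b → w * a + (1ℚ - w) * b) (𝔼-uniformSlice m+1≤k (on-slice (cong (suc ∘ suc) (m+m≡m*2 n))))
                                          (𝔼-uniformSlice m≤k (on-slice (m+m≡m*2 m)))))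
      where
      on-slice : ∀ {j l} → j ℕ.+ l ≡ k → ∀ b → weight b ≡ j → kANDProb p b ≡ p ^ℚ j * (1ℚ - p) ^ℚ l
      on-slice j+l≡k b w≡j = cong₂ (λ j l → p ^ℚ j * (1ℚ - p) ^ℚ l) w≡j (weight≡⇒zeros≡ b w≡j j+l≡k)

    tangent-gap : ∀ p → 0ℚ ≤ (1ℚ + 1ℚ) * t * (M * (P * Q) - N * (p * (1ℚ - p))) - (w * (p * p) + (1ℚ - w) * (p * (1ℚ - p)))
    tangent-gap p = *-cancelˡ-≤ (*-pos 0<M 0<D) (begin
      M * D * 0ℚ  ≡⟨ *-zeroʳ (M * D) ⟩
      0ℚ  ≤⟨ *-nonNeg (*-nonNeg (*-nonNeg (sq-nonNeg M) (<⇒≤ 0<M)) (<⇒≤ 0<s)) (sq-nonNeg (p - P)) ⟩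
      M * M * M * s * ((p - P) * (p - P))  ≡⟨ sym (drop-zero-term {y = M * M * ((M + M) * p - s * P)} (p≡q⇒p-q≡0 s*P≡1+M)) ⟩
      _  ≡⟨ sym (drop-zero-term {y = M * (P * Q) + x - M * (p * p)} (p≡q⇒p-q≡0 D*w≡M²)) ⟩
      _  ≡⟨ sym (drop-zero-term {y = D * (M * (P * Q) - N * x)} (p≡q⇒p-q≡0 2M*t≡M+w)) ⟩
      _  ≡⟨ sym (expand N P p w t) ⟩
      M * D * ((1ℚ + 1ℚ) * t * (M * (P * Q) - N * (p * (1ℚ - p))) - (w * (p * p) + (1ℚ - w) * (p * (1ℚ - p))))  ∎)
      where
      open ≤-Reasoning
      x = p * (1ℚ - p)
      -- The last three summands vanish by the defining equations of P, w and t.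
      expand : ∀ N P p w t →
        let M = 1ℚ + N
            s = 1ℚ + (M + M)
            D = M * M + (1ℚ + M) * (1ℚ + M)
            y = P * (1ℚ - P)
            x = p * (1ℚ - p)
            Z = M * y - N * x
        in M * D * ((1ℚ + 1ℚ) * t * Z - (w * (p * p) + (1ℚ - w) * x))
           ≡ M * M * M * s * ((p - P) * (p - P)) + M * M * ((M + M) * p - s * P) * (s * P - (1ℚ + M))
             + (M * y + x - M * (p * p)) * (D * w - M * M) + D * Z * ((M + M) * t - (M + w))
      expand = solve-∀ ℚ-ring

    lam-DN-bound : ∀ p → 0ℚ ≤ p → p ≤ 1ℚ →
                   w * (p ^ℚ suc m * (1ℚ - p) ^ℚ n) + (1ℚ - w) * (p ^ℚ m * (1ℚ - p) ^ℚ m) ≤ fromℕ 2 * (P * Q) ^ℚ m * t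
    lam-DN-bound p 0≤p p≤1 = begin
      w * (p ^ℚ suc m * (1ℚ - p) ^ℚ n) + (1ℚ - w) * (p ^ℚ m * (1ℚ - p) ^ℚ m)
        ≡⟨ factor w p (1ℚ - p) (p ^ℚ n) ((1ℚ - p) ^ℚ n) ⟩
      p ^ℚ n * (1ℚ - p) ^ℚ n * a  ≡⟨ cong (_* a) (sym (^ℚ-* p (1ℚ - p) n)) ⟩
      x ^ℚ n * a                  ≤⟨ tangent-bound n 0≤x 0<PQ 0≤L condition ⟩
      (P * Q) ^ℚ n * L            ≡⟨ regroup ((P * Q) ^ℚ n) (P * Q) t ⟩
      fromℕ 2 * (P * Q) ^ℚ m * t  ∎
      where
      open ≤-Reasoning
      x = p * (1ℚ - p)
      a = w * (p * p) + (1ℚ - w) * x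
      L = (1ℚ + 1ℚ) * (P * Q) * t
      Z = M * (P * Q) - N * x
      0≤x : 0ℚ ≤ x
      0≤x = *-nonNeg 0≤p (0≤q-p p≤1)
      0≤L : 0ℚ ≤ L
      0≤L = *-nonNeg (*-nonNeg (+-nonNeg 0≤1 0≤1) (<⇒≤ 0<PQ)) (<⇒≤ 0<t)
      factor : ∀ w p q A B → w * (p * (p * A) * B) + (1ℚ - w) * (p * A * (q * B))
                             ≡ A * B * (w * (p * p) + (1ℚ - w) * (p * q))
      factor = solve-∀ ℚ-ring
      regroup : ∀ Y y t → Y * ((1ℚ + 1ℚ) * y * t) ≡ (1ℚ + (1ℚ + 0ℚ)) * (y * Y) * t
      regroup = solve-∀ ℚ-ring
      split : ∀ a y t Z → a * y + y * ((1ℚ + 1ℚ) * t * Z - a) ≡ (1ℚ + 1ℚ) * y * t * Z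
      split = solve-∀ ℚ-ring
      condition : a * (P * Q) ≤ L * Z
      condition = begin
        a * (P * Q)                                    ≤⟨ p≤p+q _ (*-nonNeg (<⇒≤ 0<PQ) (tangent-gap p)) ⟩
        a * (P * Q) + P * Q * ((1ℚ + 1ℚ) * t * Z - a)  ≡⟨ split a (P * Q) t Z ⟩
        L * Z                                          ∎

    alpha-even : AlphaIs (kAND k) (fromℕ 2 * alpha' (k ℕ.+ 1))
    alpha-even = subst (λ α → AlphaIs (kAND k) (fromℕ 2 * α))
                       (sym (trans (cong alpha' (ℕₚ.+-comm k 1)) alpha'≡[PQ]^m)) (lower , upper)
      where
      c : ℚ
      c = fromℕ 2 * (P * Q) ^ℚ m
      pointwise : ∀ b → c * fromℕ (weight b) ≤ fromℕ k * kANDProb P b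
      pointwise b = begin
        c * fromℕ (weight b)                                  ≡⟨ *-assoc (fromℕ 2) ((P * Q) ^ℚ m) (fromℕ (weight b)) ⟩
        fromℕ 2 * ((P * Q) ^ℚ m * fromℕ (weight b))           ≤⟨ *-monoˡ-≤ (0≤fromℕ 2) ([PQ]^m*j≤s*P^j*Q^l (weight b) (suc (zeros b)) w+z+1≡2m+1) ⟩
        fromℕ 2 * (s * (P ^ℚ weight b * (Q * Q ^ℚ zeros b)))  ≡⟨ cong (fromℕ 2 *_) (regroup s (P ^ℚ weight b) Q (Q ^ℚ zeros b)) ⟩
        fromℕ 2 * (s * Q * kANDProb P b)                      ≡⟨ cong (λ q → fromℕ 2 * (q * kANDProb P b)) s*Q≡M ⟩
        fromℕ 2 * (M * kANDProb P b)                          ≡⟨ double M (kANDProb P b) ⟩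
        (M + M) * kANDProb P b                                ≡⟨ cong (_* kANDProb P b) (sym fromℕ-2m) ⟩
        fromℕ k * kANDProb P b                                ∎
        where
        open ≤-Reasoning
        w+z+1≡2m+1 : weight b ℕ.+ suc (zeros b) ≡ suc (m ℕ.* 2)
        w+z+1≡2m+1 = trans (ℕₚ.+-suc (weight b) (zeros b)) (cong suc (weight+zeros b))
        regroup : ∀ s A Q B → s * (A * (Q * B)) ≡ s * Q * (A * B)
        regroup = solve-∀ ℚ-ring
        double : ∀ M K → (1ℚ + (1ℚ + 0ℚ)) * (M * K) ≡ (M + M) * K
        double = solve-∀ ℚ-ring
      lower : AlphaLower (kAND k) c
      lower = alphaLower-kAND c P (*-nonNeg (0≤fromℕ 2) (^ℚ-nonNeg m (<⇒≤ 0<PQ))) (<⇒≤ 0<P) P≤1 pointwise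
      upper : AlphaUpper (kAND k) c
      upper = alphaUpper-kAND DN {t} {c} DN-isDist 0<t t≤1 onesProb-DN (λ p 0≤p p≤1 →
        subst (_≤ c * t) (sym (lam-DN p)) (lam-DN-bound p 0≤p p≤1))

open import Data.Nat using (ℕ; _≤_; _+_; parity)
open import Data.Parity.Base using (0ℙ; 1ℙ)
open import Data.Integer using (+_)
open import Data.Rational using (_*_; _/_)
open import Data.Product using (_×_)
open import Relation.Binary.PropositionalEquality using (_≡_)
open import Data.Nat using (zero; suc; s≤s)
open import Data.Product using (_,_)
open import Relation.Binary.PropositionalEquality using (refl)

theorem7p1 : ((k : ℕ) → parity k ≡ 1ℙ → 3 ≤ k → AlphaIs (kAND k) (alpha' k))
    × ((k : ℕ) → parity k ≡ 0ℙ → 2 ≤ k → AlphaIs (kAND k) ((+ 2 / 1) * alpha' (k + 1)))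
theorem7p1 = odd , even
  where
  odd : (k : ℕ) → parity k ≡ 1ℙ → 3 ≤ k → AlphaIs (kAND k) (alpha' k)
  odd k k-odd 3≤k with odd-form k k-odd | 3≤k
  ... | zero , refl | s≤s ()
  ... | suc n , refl | _ = OddCase.alpha-odd n
  even : (k : ℕ) → parity k ≡ 0ℙ → 2 ≤ k → AlphaIs (kAND k) ((+ 2 / 1) * alpha' (k + 1))
  even k k-even 2≤k with even-form k k-even | 2≤k
  ... | zero , refl | ()
  ... | suc n , refl | _ = EvenCase.alpha-even n
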